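{- Let $A$ be a finite set of non-negative integers which tiles $\mathbb{Z}$. Then $\#A$ has at most two distinct prime factors if and only if $S_A$ consists of powers of at most two primes.
   Context: A finite set $A\subset\mathbb{Z}$ tiles $\mathbb{Z}$ if there is $C\subset\mathbb{Z}$ such that every integer is uniquely $a+c$ with $a\in A$, $c\in C$. $A(x)=\sum_{a\in A}x^a$, and $S_A$ is the set of prime powers $s=q^\beta$ ($q$ prime, $\beta\geq 1$) such that the cyclotomic polynomial $\Phi_s(x)$ divides $A(x)$. -}

module Defs where

open import Data.Nat using (ℕ; zero; suc; _≤_) renaming (_*_ to _*ℕ_; _^_ to _^ℕ_)
open import Data.Nat.Divisibility using (_∣_)
open import Data.Nat.Primality using (Prime)
open import Data.Integer using (ℤ; +_) renaming (_+_ to _+ℤ_; _*_ to _*ℤ_)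
open import Data.List using (List; []; _∷_; foldr; length; replicate; _++_; map; upTo)
open import Data.List.Membership.Propositional using (_∈_)
open import Data.List.Relation.Unary.Unique.Propositional using (Unique)
open import Data.Product using (Σ; _×_; _,_; ∃-syntax)
open import Data.Sum using (_⊎_)
open import Relation.Binary.PropositionalEquality using (_≡_)

-- Polynomials with integer coefficients, as coefficient lists
-- (the i-th entry is the coefficient of x^i).

Poly : Set
Poly = List ℤ

coeff : Poly → ℕ → ℤ
coeff []      _       = + 0
coeff (a ∷ p) zero    = a
coeff (a ∷ p) (suc k) = coeff p k

infixl 6 _⊕_
infixl 7 _⊗_

_⊕_ : Poly → Poly → Poly
[]      ⊕ q       = q
(a ∷ p) ⊕ []      = a ∷ p
(a ∷ p) ⊕ (b ∷ q) = (a +ℤ b) ∷ (p ⊕ q)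

scale : ℤ → Poly → Poly
scale c = map (c *ℤ_)

_⊗_ : Poly → Poly → Poly
[]      ⊗ q = []
(a ∷ p) ⊗ q = scale a q ⊕ (+ 0 ∷ (p ⊗ q))

_≈P_ : Poly → Poly → Set
p ≈P q = ∀ k → coeff p k ≡ coeff q k

_∣P_ : Poly → Poly → Set
f ∣P g = Σ Poly λ h → (f ⊗ h) ≈P g

monomial : ℕ → Poly
monomial n = replicate n (+ 0) ++ (+ 1 ∷ [])

-- A finite set A ⊂ ℕ is a duplicate-free list; A(x) = Σ_{a ∈ A} x^a.

mask : List ℕ → Poly
mask A = foldr (λ a acc → monomial a ⊕ acc) [] A

card : List ℕ → ℕ
card = length

-- Cyclotomic polynomial of a prime power s = q^(b+1):
--   Φ_{q^(b+1)}(x) = Σ_{j<q} x^(j·q^b)  (standard closed form).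

Φpp : ℕ → ℕ → Poly
Φpp q b = foldr (λ j acc → monomial (j *ℕ (q ^ℕ b)) ⊕ acc) [] (upTo q)

-- s ∈ S_A, with s = q^(b+1), q prime
InS : List ℕ → ℕ → ℕ → Set
InS A q b = Prime q × (Φpp q b ∣P mask A)

Tiles : List ℕ → Set₁
Tiles A = Σ (ℤ → Set) λ C → ∀ (z : ℤ) →
  Σ ℕ λ a → Σ ℤ λ c → (a ∈ A × C c × z ≡ (+ a) +ℤ c) ×
    (∀ (a' : ℕ) (c' : ℤ) → a' ∈ A → C c' → z ≡ (+ a') +ℤ c' → a' ≡ a × c' ≡ c)

AtMostTwoPrimeFactors : ℕ → Set
AtMostTwoPrimeFactors n = ∃[ p ] ∃[ r ] (Prime p × Prime r ×
  (∀ q → Prime q → q ∣ n → q ≡ p ⊎ q ≡ r))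

SAtMostTwoPrimes : List ℕ → Set
SAtMostTwoPrimes A = ∃[ p ] ∃[ r ] (Prime p × Prime r ×
  (∀ q b → InS A q b → q ≡ p ⊎ q ≡ r))

-- One direction is evaluation at x = 1: Φ_{q^k}(1) = q, so every prime of S_A divides #A = A(1).
--
-- Conversely, a tiling by a finite set is periodic; reducing modulo the period M gives a finite C with
-- A ⊕ C = ℤ_M, that is A(x) C(x) ≡ 1 + x + ⋯ + x^(M−1) (mod x^M − 1), and #A · #C = M. Suppose the prime
-- q divides #A but no Φ_{q^k} divides A(x). Write J_n = 1 + x + ⋯ + x^(n−1), so J_{q^(j+1)} = J_{q^j} Φ_{q^(j+1)}.
-- If J_{q^j} divides C(x) then q^(j+1) divides #A · #C = M, so Φ_{q^(j+1)} divides J_M and hence A(x) C(x);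
-- as Φ_{q^(j+1)} is prime in ℤ[x] and divides neither A(x) nor J_{q^j}, J_{q^(j+1)} divides C(x). Thus every
-- power of q divides #C > 0, which is absurd.
--
-- Primality of Φ = Φ_{q^k} is shown in ℤ[x]/Φ, where π = 1 − x satisfies π^(q^k) ≡ q u (the Frobenius
-- congruence modulo q) and Φ(1) = q. If U(1) is divisible by q then U ≡ π U′, since U − cΦ vanishes at 1.
-- Peeling off factors of π from some F not divisible by Φ must stop at F ≡ π^i U with q ∤ U(1): otherwise
-- F ≡ π^(S q^k) U′ ≡ q^S u^S U′, so the coefficients of the reduction of F modulo the monic Φ are multiples
-- of q^S, yet bounded by S. Finally Φ cannot divide a product U V of such units, since q ∤ U(1) V(1), and π
-- cancels modulo Φ because Φ(1) ≠ 0.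
module Submission where

open import Defs
open import Data.Integer using (+_)
open import Data.List using (List)
open import Data.List.Relation.Unary.Unique.Propositional using (Unique)
open import Data.Nat using (ℕ; zero; suc; NonZero)
open import Data.Nat.Primality using (Prime)
open import Function.Bundles using (_⇔_)
open import Relation.Binary.PropositionalEquality using (_≡_)

module Polynomial where

  open import Algebra.Bundles using (CommutativeRing; module CommutativeRing; module Semiring)
  open import Algebra.Structures using (IsCommutativeRing)
  open import Data.Integer as ℤ using (ℤ; +_; -_; _+_; _*_)
  import Data.Integer.Properties as ℤ
  open import Data.Integer.Tactic.RingSolver using (solve-∀)
  open import Data.List using ([]; _∷_; map)
  open import Data.Nat using (zero; suc)
  open import Data.Product using (_,_)
  open import Level using (0ℓ)
  open import Relation.Binary.Bundles using (Setoid)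
  open import Relation.Binary.PropositionalEquality
  open import Relation.Binary.Structures using (IsEquivalence)
  import Relation.Binary.Reasoning.Setoid as SetoidReasoning

  infix 4 _≋_

  -- Wrapping _≈P_ in a record lets Agda infer both polynomials from an equation between them.
  record _≋_ (p q : Poly) : Set where
    constructor mk≋
    field coeff-≡ : p ≈P q
  open _≋_ public

  ≋-refl : ∀ {p} → p ≋ p
  ≋-refl = mk≋ λ _ → refl

  ≋-sym : ∀ {p q} → p ≋ q → q ≋ p
  ≋-sym (mk≋ e) = mk≋ λ k → sym (e k)

  ≋-trans : ∀ {p q r} → p ≋ q → q ≋ r → p ≋ r
  ≋-trans (mk≋ e) (mk≋ f) = mk≋ λ k → trans (e k) (f k)

  ≋-reflexive : ∀ {p q} → p ≡ q → p ≋ q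
  ≋-reflexive refl = ≋-refl

  ≋-isEquivalence : IsEquivalence _≋_
  ≋-isEquivalence = record { refl = ≋-refl ; sym = ≋-sym ; trans = ≋-trans }

  ≋-setoid : Setoid 0ℓ 0ℓ
  ≋-setoid = record { isEquivalence = ≋-isEquivalence }

  neg : Poly → Poly
  neg = map -_

  shift : Poly → Poly
  shift p = + 0 ∷ p

  const : ℤ → Poly
  const c = c ∷ []

  1P : Poly
  1P = const (+ 1)

  X : Poly
  X = + 0 ∷ + 1 ∷ []

  const-0 : const (+ 0) ≋ []
  const-0 = mk≋ λ { zero → refl ; (suc k) → refl }

  coeff-⊕ : ∀ p q k → coeff (p ⊕ q) k ≡ coeff p k + coeff q k
  coeff-⊕ []      q       k       = sym (ℤ.+-identityˡ (coeff q k))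
  coeff-⊕ (a ∷ p) []      k       = sym (ℤ.+-identityʳ (coeff (a ∷ p) k))
  coeff-⊕ (a ∷ p) (b ∷ q) zero    = refl
  coeff-⊕ (a ∷ p) (b ∷ q) (suc k) = coeff-⊕ p q k

  coeff-scale : ∀ c p k → coeff (scale c p) k ≡ c * coeff p k
  coeff-scale c []      k       = sym (ℤ.*-zeroʳ c)
  coeff-scale c (a ∷ p) zero    = refl
  coeff-scale c (a ∷ p) (suc k) = coeff-scale c p k

  coeff-neg : ∀ p k → coeff (neg p) k ≡ - coeff p k
  coeff-neg []      k       = refl
  coeff-neg (a ∷ p) zero    = refl
  coeff-neg (a ∷ p) (suc k) = coeff-neg p k

  coeff-∷-⊗ : ∀ a p q k → coeff ((a ∷ p) ⊗ q) k ≡ a * coeff q k + coeff (shift (p ⊗ q)) k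
  coeff-∷-⊗ a p q k = trans (coeff-⊕ (scale a q) (shift (p ⊗ q)) k)
                            (cong (_+ coeff (shift (p ⊗ q)) k) (coeff-scale a q k))

  ⊕-cong : ∀ {p p′ q q′} → p ≋ p′ → q ≋ q′ → p ⊕ q ≋ p′ ⊕ q′
  ⊕-cong {p} {p′} {q} {q′} (mk≋ e) (mk≋ f) = mk≋ λ k → begin
    coeff (p ⊕ q) k           ≡⟨ coeff-⊕ p q k ⟩
    coeff p k + coeff q k     ≡⟨ cong₂ _+_ (e k) (f k) ⟩
    coeff p′ k + coeff q′ k   ≡⟨ coeff-⊕ p′ q′ k ⟨
    coeff (p′ ⊕ q′) k         ∎
    where open ≡-Reasoning

  ⊕-congˡ : ∀ p {q q′} → q ≋ q′ → p ⊕ q ≋ p ⊕ q′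
  ⊕-congˡ p = ⊕-cong (≋-refl {p})

  ⊕-congʳ : ∀ q {p p′} → p ≋ p′ → p ⊕ q ≋ p′ ⊕ q
  ⊕-congʳ q e = ⊕-cong e (≋-refl {q})

  shift-cong : ∀ {p q} → p ≋ q → shift p ≋ shift q
  shift-cong (mk≋ e) = mk≋ λ { zero → refl ; (suc k) → e k }

  neg-cong : ∀ {p q} → p ≋ q → neg p ≋ neg q
  neg-cong {p} {q} (mk≋ e) = mk≋ λ k →
    trans (coeff-neg p k) (trans (cong -_ (e k)) (sym (coeff-neg q k)))

  ⊗-zeroˡ : ∀ {p} q → p ≋ [] → p ⊗ q ≋ []
  ⊗-zeroˡ {[]}    q _       = ≋-refl
  ⊗-zeroˡ {a ∷ p} q (mk≋ e) = mk≋ λ k → begin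
    coeff ((a ∷ p) ⊗ q) k                     ≡⟨ coeff-∷-⊗ a p q k ⟩
    a * coeff q k + coeff (shift (p ⊗ q)) k   ≡⟨ cong₂ _+_ (cong (_* coeff q k) (e 0)) (tail-zero k) ⟩
    + 0 * coeff q k + + 0                     ≡⟨ ℤ.+-identityʳ (+ 0 * coeff q k) ⟩
    + 0 * coeff q k                           ≡⟨ ℤ.*-zeroˡ (coeff q k) ⟩
    + 0                                       ∎
    where
    open ≡-Reasoning
    tail-zero : ∀ k → coeff (shift (p ⊗ q)) k ≡ + 0
    tail-zero zero    = refl
    tail-zero (suc k) = coeff-≡ (⊗-zeroˡ {p} q (mk≋ λ j → e (suc j))) k

  ⊗-congʳ : ∀ q {p p′} → p ≋ p′ → p ⊗ q ≋ p′ ⊗ q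
  ⊗-congʳ q {[]}    {p′}     e = ≋-sym (⊗-zeroˡ q (≋-sym e))
  ⊗-congʳ q {a ∷ p} {[]}     e = ⊗-zeroˡ q e
  ⊗-congʳ q {a ∷ p} {b ∷ p′} (mk≋ e) =
    ⊕-cong (mk≋ λ k → trans (coeff-scale a q k) (trans (cong (_* coeff q k) (e 0)) (sym (coeff-scale b q k))))
           (shift-cong (⊗-congʳ q {p} {p′} (mk≋ λ k → e (suc k))))

  scale-cong : ∀ c {p q} → p ≋ q → scale c p ≋ scale c q
  scale-cong c {p} {q} (mk≋ e) = mk≋ λ k →
    trans (coeff-scale c p k) (trans (cong (c *_) (e k)) (sym (coeff-scale c q k)))

  ⊗-congˡ : ∀ p {q q′} → q ≋ q′ → p ⊗ q ≋ p ⊗ q′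
  ⊗-congˡ []      e = ≋-refl
  ⊗-congˡ (a ∷ p) e = ⊕-cong (scale-cong a e) (shift-cong (⊗-congˡ p e))

  ⊗-cong : ∀ {p p′ q q′} → p ≋ p′ → q ≋ q′ → p ⊗ q ≋ p′ ⊗ q′
  ⊗-cong {p} {p′} {q} e f = ≋-trans (⊗-congʳ q e) (⊗-congˡ p′ f)

  ⊗-zeroʳ : ∀ p → p ⊗ [] ≋ []
  ⊗-zeroʳ []      = ≋-refl
  ⊗-zeroʳ (a ∷ p) = mk≋ λ
    { zero    → refl
    ; (suc k) → coeff-≡ (⊗-zeroʳ p) k }

  ⊕-identityˡ : ∀ p → [] ⊕ p ≋ p
  ⊕-identityˡ p = ≋-refl

  ⊕-identityʳ : ∀ p → p ⊕ [] ≋ p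
  ⊕-identityʳ []      = ≋-refl
  ⊕-identityʳ (a ∷ p) = ≋-refl

  const⊗≋scale : ∀ c p → const c ⊗ p ≋ scale c p
  const⊗≋scale c p = ≋-trans (⊕-congˡ (scale c p) const-0) (⊕-identityʳ (scale c p))

  ⊕-comm : ∀ p q → p ⊕ q ≋ q ⊕ p
  ⊕-comm p q = mk≋ λ k →
    trans (coeff-⊕ p q k) (trans (ℤ.+-comm (coeff p k) (coeff q k)) (sym (coeff-⊕ q p k)))

  ⊕-assoc : ∀ p q r → (p ⊕ q) ⊕ r ≋ p ⊕ (q ⊕ r)
  ⊕-assoc p q r = mk≋ λ k → begin
    coeff ((p ⊕ q) ⊕ r) k                 ≡⟨ coeff-⊕ (p ⊕ q) r k ⟩
    coeff (p ⊕ q) k + coeff r k           ≡⟨ cong (_+ coeff r k) (coeff-⊕ p q k) ⟩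
    coeff p k + coeff q k + coeff r k     ≡⟨ ℤ.+-assoc (coeff p k) (coeff q k) (coeff r k) ⟩
    coeff p k + (coeff q k + coeff r k)   ≡⟨ cong (_+_ (coeff p k)) (coeff-⊕ q r k) ⟨
    coeff p k + coeff (q ⊕ r) k           ≡⟨ coeff-⊕ p (q ⊕ r) k ⟨
    coeff (p ⊕ (q ⊕ r)) k                 ∎
    where open ≡-Reasoning

  ⊕-inverseʳ : ∀ p → p ⊕ neg p ≋ []
  ⊕-inverseʳ p = mk≋ λ k → begin
    coeff (p ⊕ neg p) k           ≡⟨ coeff-⊕ p (neg p) k ⟩
    coeff p k + coeff (neg p) k   ≡⟨ cong (_+_ (coeff p k)) (coeff-neg p k) ⟩
    coeff p k + - coeff p k       ≡⟨ ℤ.+-inverseʳ (coeff p k) ⟩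
    + 0                           ∎
    where open ≡-Reasoning

  ⊕-inverseˡ : ∀ p → neg p ⊕ p ≋ []
  ⊕-inverseˡ p = ≋-trans (⊕-comm (neg p) p) (⊕-inverseʳ p)

  ⊕-neg≋[]⇒≋ : ∀ {p q} → p ⊕ neg q ≋ [] → p ≋ q
  ⊕-neg≋[]⇒≋ {p} {q} p-q≋[] = begin
    p                     ≈⟨ ⊕-identityʳ p ⟨
    p ⊕ []                ≈⟨ ⊕-congˡ p (⊕-inverseˡ q) ⟨
    p ⊕ (neg q ⊕ q)       ≈⟨ ⊕-assoc p (neg q) q ⟨
    (p ⊕ neg q) ⊕ q       ≈⟨ ⊕-congʳ q p-q≋[] ⟩
    [] ⊕ q                ∎
    where open SetoidReasoning ≋-setoid

  const-* : ∀ a b → const (a * b) ≋ const a ⊗ const b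
  const-* a b = mk≋ λ { zero → sym (ℤ.+-identityʳ (a * b)) ; (suc zero) → refl ; (suc (suc k)) → refl }

  scale-⊕ : ∀ c p q → scale c (p ⊕ q) ≋ scale c p ⊕ scale c q
  scale-⊕ c p q = mk≋ λ k → begin
    coeff (scale c (p ⊕ q)) k                    ≡⟨ coeff-scale c (p ⊕ q) k ⟩
    c * coeff (p ⊕ q) k                          ≡⟨ cong (c *_) (coeff-⊕ p q k) ⟩
    c * (coeff p k + coeff q k)                  ≡⟨ ℤ.*-distribˡ-+ c (coeff p k) (coeff q k) ⟩
    c * coeff p k + c * coeff q k                ≡⟨ cong₂ _+_ (coeff-scale c p k) (coeff-scale c q k) ⟨
    coeff (scale c p) k + coeff (scale c q) k    ≡⟨ coeff-⊕ (scale c p) (scale c q) k ⟨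
    coeff (scale c p ⊕ scale c q) k              ∎
    where open ≡-Reasoning

  scale-distribʳ : ∀ a b q → scale (a + b) q ≋ scale a q ⊕ scale b q
  scale-distribʳ a b q = mk≋ λ k → begin
    coeff (scale (a + b) q) k                    ≡⟨ coeff-scale (a + b) q k ⟩
    (a + b) * coeff q k                          ≡⟨ ℤ.*-distribʳ-+ (coeff q k) a b ⟩
    a * coeff q k + b * coeff q k                ≡⟨ cong₂ _+_ (coeff-scale a q k) (coeff-scale b q k) ⟨
    coeff (scale a q) k + coeff (scale b q) k    ≡⟨ coeff-⊕ (scale a q) (scale b q) k ⟨
    coeff (scale a q ⊕ scale b q) k              ∎
    where open ≡-Reasoning

  scale-scale : ∀ a b q → scale a (scale b q) ≋ scale (a * b) q
  scale-scale a b q = mk≋ λ k → begin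
    coeff (scale a (scale b q)) k   ≡⟨ coeff-scale a (scale b q) k ⟩
    a * coeff (scale b q) k         ≡⟨ cong (a *_) (coeff-scale b q k) ⟩
    a * (b * coeff q k)             ≡⟨ ℤ.*-assoc a b (coeff q k) ⟨
    a * b * coeff q k               ≡⟨ coeff-scale (a * b) q k ⟨
    coeff (scale (a * b) q) k       ∎
    where open ≡-Reasoning

  scale-identity : ∀ p → scale (+ 1) p ≋ p
  scale-identity p = mk≋ λ k → trans (coeff-scale (+ 1) p k) (ℤ.*-identityˡ (coeff p k))

  scale-shift : ∀ c p → scale c (shift p) ≋ shift (scale c p)
  scale-shift c p = mk≋ λ { zero → ℤ.*-zeroʳ c ; (suc k) → refl }

  ⊕-interchange : ∀ p q r s → (p ⊕ q) ⊕ (r ⊕ s) ≋ (p ⊕ r) ⊕ (q ⊕ s)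
  ⊕-interchange p q r s = mk≋ λ k → begin
    coeff ((p ⊕ q) ⊕ (r ⊕ s)) k                                ≡⟨ coeff-⊕ (p ⊕ q) (r ⊕ s) k ⟩
    coeff (p ⊕ q) k + coeff (r ⊕ s) k                          ≡⟨ cong₂ _+_ (coeff-⊕ p q k) (coeff-⊕ r s k) ⟩
    coeff p k + coeff q k + (coeff r k + coeff s k)            ≡⟨ interchange (coeff p k) (coeff q k) (coeff r k) (coeff s k) ⟩
    coeff p k + coeff r k + (coeff q k + coeff s k)            ≡⟨ cong₂ _+_ (coeff-⊕ p r k) (coeff-⊕ q s k) ⟨
    coeff (p ⊕ r) k + coeff (q ⊕ s) k                          ≡⟨ coeff-⊕ (p ⊕ r) (q ⊕ s) k ⟨
    coeff ((p ⊕ r) ⊕ (q ⊕ s)) k                                ∎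
    where
    open ≡-Reasoning
    interchange : ∀ a b c d → a + b + (c + d) ≡ a + c + (b + d)
    interchange = solve-∀

  ⊗-distribʳ : ∀ p q r → (p ⊕ q) ⊗ r ≋ p ⊗ r ⊕ q ⊗ r
  ⊗-distribʳ []      q       r = ≋-refl
  ⊗-distribʳ (a ∷ p) []      r = ≋-sym (⊕-identityʳ ((a ∷ p) ⊗ r))
  ⊗-distribʳ (a ∷ p) (b ∷ q) r =
    ≋-trans (⊕-cong (scale-distribʳ a b r) (shift-cong (⊗-distribʳ p q r)))
            (⊕-interchange (scale a r) (scale b r) (shift (p ⊗ r)) (shift (q ⊗ r)))

  scale-⊗ : ∀ c p q → scale c p ⊗ q ≋ scale c (p ⊗ q)
  scale-⊗ c []      q = ≋-refl
  scale-⊗ c (a ∷ p) q = begin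
    scale (c * a) q ⊕ shift (scale c p ⊗ q)          ≈⟨ ⊕-cong (≋-sym (scale-scale c a q)) (shift-cong (scale-⊗ c p q)) ⟩
    scale c (scale a q) ⊕ shift (scale c (p ⊗ q))    ≈⟨ ⊕-cong ≋-refl (scale-shift c (p ⊗ q)) ⟨
    scale c (scale a q) ⊕ scale c (shift (p ⊗ q))    ≈⟨ scale-⊕ c (scale a q) (shift (p ⊗ q)) ⟨
    scale c (scale a q ⊕ shift (p ⊗ q))              ∎
    where open SetoidReasoning ≋-setoid

  shift-⊗ : ∀ p q → shift p ⊗ q ≋ shift (p ⊗ q)
  shift-⊗ p q = ≋-trans (⊕-cong {scale (+ 0) q} {[]} (mk≋ λ k → trans (coeff-scale (+ 0) q k) (ℤ.*-zeroˡ (coeff q k))) ≋-refl)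
                        (⊕-identityˡ (shift (p ⊗ q)))

  ⊗-assoc : ∀ p q r → (p ⊗ q) ⊗ r ≋ p ⊗ (q ⊗ r)
  ⊗-assoc []      q r = ≋-refl
  ⊗-assoc (a ∷ p) q r =
    ≋-trans (⊗-distribʳ (scale a q) (shift (p ⊗ q)) r)
            (⊕-cong (scale-⊗ a q r) (≋-trans (shift-⊗ (p ⊗ q) r) (shift-cong (⊗-assoc p q r))))

  ⊗-∷ʳ : ∀ p b q → p ⊗ (b ∷ q) ≋ scale b p ⊕ shift (p ⊗ q)
  ⊗-∷ʳ []      b q = mk≋ λ { zero → refl ; (suc k) → refl }
  ⊗-∷ʳ (a ∷ p) b q = mk≋ λ
    { zero    → cong (_+ + 0) (ℤ.*-comm a b)
    ; (suc k) → begin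
        coeff (scale a q ⊕ p ⊗ (b ∷ q)) k                                  ≡⟨ coeff-⊕ (scale a q) (p ⊗ (b ∷ q)) k ⟩
        coeff (scale a q) k + coeff (p ⊗ (b ∷ q)) k                        ≡⟨ cong₂ _+_ (coeff-scale a q k) (coeff-≡ (⊗-∷ʳ p b q) k) ⟩
        a * coeff q k + coeff (scale b p ⊕ shift (p ⊗ q)) k               ≡⟨ cong (_+_ (a * coeff q k)) (coeff-⊕ (scale b p) (shift (p ⊗ q)) k) ⟩
        a * coeff q k + (coeff (scale b p) k + coeff (shift (p ⊗ q)) k)   ≡⟨ swap (a * coeff q k) (coeff (scale b p) k) (coeff (shift (p ⊗ q)) k) ⟩
        coeff (scale b p) k + (a * coeff q k + coeff (shift (p ⊗ q)) k)   ≡⟨ cong (_+_ (coeff (scale b p) k)) (coeff-∷-⊗ a p q k) ⟨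
        coeff (scale b p) k + coeff ((a ∷ p) ⊗ q) k                        ≡⟨ coeff-⊕ (scale b p) ((a ∷ p) ⊗ q) k ⟨
        coeff (scale b p ⊕ (a ∷ p) ⊗ q) k                                  ∎ }
    where
    open ≡-Reasoning
    swap : ∀ x y z → x + (y + z) ≡ y + (x + z)
    swap = solve-∀

  ⊗-comm : ∀ p q → p ⊗ q ≋ q ⊗ p
  ⊗-comm []      q = ≋-sym (⊗-zeroʳ q)
  ⊗-comm (a ∷ p) q = ≋-trans (⊕-cong ≋-refl (shift-cong (⊗-comm p q))) (≋-sym (⊗-∷ʳ q a p))

  ⊗-distribˡ : ∀ p q r → p ⊗ (q ⊕ r) ≋ p ⊗ q ⊕ p ⊗ r
  ⊗-distribˡ p q r =
    ≋-trans (⊗-comm p (q ⊕ r)) (≋-trans (⊗-distribʳ q r p) (⊕-cong (⊗-comm q p) (⊗-comm r p)))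

  ⊗-identityˡ : ∀ p → 1P ⊗ p ≋ p
  ⊗-identityˡ p = ≋-trans (⊕-cong (scale-identity p) ≋-refl) (mk≋ λ k → trans (coeff-⊕ p (+ 0 ∷ []) k) (trans (cong (_+_ (coeff p k)) (zero-const k)) (ℤ.+-identityʳ (coeff p k))))
    where
    zero-const : ∀ k → coeff (+ 0 ∷ []) k ≡ + 0
    zero-const zero    = refl
    zero-const (suc k) = refl

  ⊗-identityʳ : ∀ p → p ⊗ 1P ≋ p
  ⊗-identityʳ p = ≋-trans (⊗-comm p 1P) (⊗-identityˡ p)

  ℤ[X]-isCommutativeRing : IsCommutativeRing _≋_ _⊕_ _⊗_ neg [] 1P
  ℤ[X]-isCommutativeRing = record
    { isRing = record
      { +-isAbelianGroup = record
        { isGroup = record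
          { isMonoid = record
            { isSemigroup = record
              { isMagma = record { isEquivalence = ≋-isEquivalence ; ∙-cong = ⊕-cong }
              ; assoc = ⊕-assoc }
            ; identity = ⊕-identityˡ , ⊕-identityʳ }
          ; inverse = ⊕-inverseˡ , ⊕-inverseʳ
          ; ⁻¹-cong = neg-cong }
        ; comm = ⊕-comm }
      ; *-cong = ⊗-cong
      ; *-assoc = ⊗-assoc
      ; *-identity = ⊗-identityˡ , ⊗-identityʳ
      ; distrib = ⊗-distribˡ , λ r p q → ⊗-distribʳ p q r }
    ; *-comm = ⊗-comm }

  ℤ[X] : CommutativeRing 0ℓ 0ℓ
  ℤ[X] = record { isCommutativeRing = ℤ[X]-isCommutativeRing }

  open import Algebra.Definitions.RawSemiring (Semiring.rawSemiring (CommutativeRing.semiring ℤ[X])) public using (_^_)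

  1P^≋1P : ∀ n → 1P ^ n ≋ 1P
  1P^≋1P zero    = ≋-refl
  1P^≋1P (suc n) = ≋-trans (⊗-identityˡ (1P ^ n)) (1P^≋1P n)

module ℤ[X]-Solver where

  open import Algebra.Solver.Ring.AlmostCommutativeRing
  open import Data.Integer as ℤ using (+-*-rawRing)
  open import Data.Maybe using (Maybe; just; nothing)
  open import Relation.Binary.PropositionalEquality using (refl)
  open import Relation.Nullary using (yes; no)
  open Polynomial

  const-homomorphism : +-*-rawRing -Raw-AlmostCommutative⟶ fromCommutativeRing ℤ[X]
  const-homomorphism = record
    { ⟦_⟧    = const
    ; +-homo = λ _ _ → ≋-refl
    ; *-homo = const-*
    ; -‿homo = λ _ → ≋-refl
    ; 0-homo = const-0
    ; 1-homo = ≋-refl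
    }

  const-≟ : ∀ a b → Maybe (const a ≋ const b)
  const-≟ a b with a ℤ.≟ b
  ... | yes refl = just ≋-refl
  ... | no  _    = nothing

  open import Algebra.Solver.Ring +-*-rawRing (fromCommutativeRing ℤ[X]) const-homomorphism const-≟ public

module Divisibility where

  open import Data.List using ([])
  open import Data.Product using (_,_)
  open Polynomial
  open ℤ[X]-Solver using (solve; _:=_; _:*_)

  infix 4 _∣_

  record _∣_ (g p : Poly) : Set where
    constructor divides
    field
      quotient : Poly
      equality : g ⊗ quotient ≋ p
  open _∣_ public

  ∣⇒∣P : ∀ {g p} → g ∣ p → g ∣P p
  ∣⇒∣P (divides h (mk≋ e)) = h , e

  ∣P⇒∣ : ∀ {g p} → g ∣P p → g ∣ p
  ∣P⇒∣ (h , e) = divides h (mk≋ e)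

  ∣-respʳ : ∀ {g p q} → p ≋ q → g ∣ p → g ∣ q
  ∣-respʳ e (divides h f) = divides h (≋-trans f e)

  ∣-refl : ∀ {g} → g ∣ g
  ∣-refl {g} = divides 1P (⊗-identityʳ g)

  ∣-trans : ∀ {f g p} → f ∣ g → g ∣ p → f ∣ p
  ∣-trans {f} (divides h e) (divides h′ e′) =
    divides (h ⊗ h′) (≋-trans (≋-sym (⊗-assoc f h h′)) (≋-trans (⊗-congʳ h′ e) e′))

  ∣[] : ∀ {g} → g ∣ []
  ∣[] {g} = divides [] (⊗-zeroʳ g)

  ∣-⊕ : ∀ {g p q} → g ∣ p → g ∣ q → g ∣ p ⊕ q
  ∣-⊕ {g} (divides h e) (divides h′ e′) = divides (h ⊕ h′) (≋-trans (⊗-distribˡ g h h′) (⊕-cong e e′))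

  ∣-⊗ˡ : ∀ {g} r {p} → g ∣ p → g ∣ r ⊗ p
  ∣-⊗ˡ {g} r (divides h e) = divides (r ⊗ h) (≋-trans (swap g r h) (⊗-congˡ r e))
    where
    swap : ∀ g r h → g ⊗ (r ⊗ h) ≋ r ⊗ (g ⊗ h)
    swap = solve 3 (λ g r h → g :* (r :* h) := r :* (g :* h)) ≋-refl

module Congruence (g : Poly) where

  open import Algebra.Bundles using (CommutativeRing)
  open import Relation.Binary.Bundles using (Setoid)
  open import Data.Integer using (+_; -_)
  open import Data.List using ([])
  open import Data.Nat using (zero; suc)
  open import Data.Product using (_,_)
  open import Level using (0ℓ)
  open import Relation.Binary.Structures using (IsEquivalence)
  open Polynomial
  open Divisibility
  open ℤ[X]-Solver using (solve; _:=_; _:+_; _:*_; _:-_; :-_; con)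

  infix 4 _≈_

  record _≈_ (p q : Poly) : Set where
    constructor mk≈
    field divides-difference : g ∣ p ⊕ neg q
  open _≈_ public

  ≋⇒≈ : ∀ {p q} → p ≋ q → p ≈ q
  ≋⇒≈ {p} {q} e = mk≈ (∣-respʳ (≋-sym (≋-trans (⊕-cong e ≋-refl) (⊕-inverseʳ q))) ∣[])

  ∣⇒≈[] : ∀ {p} → g ∣ p → p ≈ []
  ∣⇒≈[] {p} d = mk≈ (∣-respʳ (≋-sym (⊕-identityʳ p)) d)

  ≈[]⇒∣ : ∀ {p} → p ≈ [] → g ∣ p
  ≈[]⇒∣ {p} (mk≈ d) = ∣-respʳ (⊕-identityʳ p) d

  ≈-refl : ∀ {p} → p ≈ p
  ≈-refl = ≋⇒≈ ≋-refl

  ≈-sym : ∀ {p q} → p ≈ q → q ≈ p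
  ≈-sym {p} {q} (mk≈ d) = mk≈ (∣-respʳ (flip p q) (∣-⊗ˡ (const (- + 1)) d))
    where
    flip : ∀ p q → const (- + 1) ⊗ (p ⊕ neg q) ≋ q ⊕ neg p
    flip = solve 2 (λ p q → con (- + 1) :* (p :- q) := q :- p) ≋-refl

  ≈-trans : ∀ {p q r} → p ≈ q → q ≈ r → p ≈ r
  ≈-trans {p} {q} {r} (mk≈ d) (mk≈ d′) = mk≈ (∣-respʳ (telescope p q r) (∣-⊕ d d′))
    where
    telescope : ∀ p q r → (p ⊕ neg q) ⊕ (q ⊕ neg r) ≋ p ⊕ neg r
    telescope = solve 3 (λ p q r → (p :- q) :+ (q :- r) := p :- r) ≋-refl

  ⊕-cong≈ : ∀ {p p′ q q′} → p ≈ p′ → q ≈ q′ → p ⊕ q ≈ p′ ⊕ q′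
  ⊕-cong≈ {p} {p′} {q} {q′} (mk≈ d) (mk≈ d′) = mk≈ (∣-respʳ (regroup p p′ q q′) (∣-⊕ d d′))
    where
    regroup : ∀ p p′ q q′ → (p ⊕ neg p′) ⊕ (q ⊕ neg q′) ≋ (p ⊕ q) ⊕ neg (p′ ⊕ q′)
    regroup = solve 4 (λ p p′ q q′ → (p :- p′) :+ (q :- q′) := (p :+ q) :- (p′ :+ q′)) ≋-refl

  ⊗-cong≈ : ∀ {p p′ q q′} → p ≈ p′ → q ≈ q′ → p ⊗ q ≈ p′ ⊗ q′
  ⊗-cong≈ {p} {p′} {q} {q′} (mk≈ d) (mk≈ d′) =
    mk≈ (∣-respʳ (regroup p p′ q q′) (∣-⊕ (∣-⊗ˡ q d) (∣-⊗ˡ p′ d′)))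
    where
    regroup : ∀ p p′ q q′ → q ⊗ (p ⊕ neg p′) ⊕ p′ ⊗ (q ⊕ neg q′) ≋ p ⊗ q ⊕ neg (p′ ⊗ q′)
    regroup = solve 4 (λ p p′ q q′ → q :* (p :- p′) :+ p′ :* (q :- q′) := p :* q :- p′ :* q′) ≋-refl

  neg-cong≈ : ∀ {p p′} → p ≈ p′ → neg p ≈ neg p′
  neg-cong≈ {p} {p′} (mk≈ d) = mk≈ (∣-respʳ (negate p p′) (∣-⊗ˡ (const (- + 1)) d))
    where
    negate : ∀ p q → const (- + 1) ⊗ (p ⊕ neg q) ≋ neg p ⊕ neg (neg q)
    negate = solve 2 (λ p q → con (- + 1) :* (p :- q) := (:- p) :- (:- q)) ≋-refl

  ^-cong≈ : ∀ {p p′} n → p ≈ p′ → p ^ n ≈ p′ ^ n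
  ^-cong≈ zero    _ = ≈-refl
  ^-cong≈ (suc n) e = ⊗-cong≈ e (^-cong≈ n e)

  ≈-isEquivalence : IsEquivalence _≈_
  ≈-isEquivalence = record { refl = ≈-refl ; sym = ≈-sym ; trans = ≈-trans }

  quotientRing : CommutativeRing 0ℓ 0ℓ
  quotientRing = record
    { isCommutativeRing = record
      { isRing = record
        { +-isAbelianGroup = record
          { isGroup = record
            { isMonoid = record
              { isSemigroup = record
                { isMagma = record { isEquivalence = ≈-isEquivalence ; ∙-cong = ⊕-cong≈ }
                ; assoc = λ p q r → ≋⇒≈ (⊕-assoc p q r) }
              ; identity = (λ _ → ≈-refl) , λ p → ≋⇒≈ (⊕-identityʳ p) }
            ; inverse = (λ p → ≋⇒≈ (⊕-inverseˡ p)) , λ p → ≋⇒≈ (⊕-inverseʳ p)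
            ; ⁻¹-cong = neg-cong≈ }
          ; comm = λ p q → ≋⇒≈ (⊕-comm p q) }
        ; *-cong = ⊗-cong≈
        ; *-assoc = λ p q r → ≋⇒≈ (⊗-assoc p q r)
        ; *-identity = (λ p → ≋⇒≈ (⊗-identityˡ p)) , λ p → ≋⇒≈ (⊗-identityʳ p)
        ; distrib = (λ p q r → ≋⇒≈ (⊗-distribˡ p q r)) , λ r p q → ≋⇒≈ (⊗-distribʳ p q r) }
      ; *-comm = λ p q → ≋⇒≈ (⊗-comm p q) } }

  ≈-setoid : Setoid 0ℓ 0ℓ
  ≈-setoid = CommutativeRing.setoid quotientRing

module Evaluation where

  open import Data.Integer as ℤ using (ℤ; +_; -_; _+_; _*_)
  import Data.Integer.Divisibility as ℤ
  import Data.Integer.Properties as ℤ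
  open import Data.Integer.Tactic.RingSolver using (solve-∀)
  open import Data.List using ([]; _∷_)
  open import Data.Nat as ℕ using (ℕ; zero; suc)
  open import Data.Nat.Divisibility using (divides)
  open import Relation.Binary.PropositionalEquality
  open Polynomial
  open Divisibility using (_∣_; divides)

  eval : ℤ → Poly → ℤ
  eval t []      = + 0
  eval t (a ∷ p) = a + t * eval t p

  eval-⊕ : ∀ t p q → eval t (p ⊕ q) ≡ eval t p + eval t q
  eval-⊕ t []      q       = sym (ℤ.+-identityˡ (eval t q))
  eval-⊕ t (a ∷ p) []      = sym (ℤ.+-identityʳ (eval t (a ∷ p)))
  eval-⊕ t (a ∷ p) (b ∷ q) = trans (cong (λ v → a + b + t * v) (eval-⊕ t p q)) (regroup a b t (eval t p) (eval t q))
    where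
    regroup : ∀ a b t x y → a + b + t * (x + y) ≡ a + t * x + (b + t * y)
    regroup = solve-∀

  eval-scale : ∀ t c p → eval t (scale c p) ≡ c * eval t p
  eval-scale t c []      = sym (ℤ.*-zeroʳ c)
  eval-scale t c (a ∷ p) = trans (cong (λ v → c * a + t * v) (eval-scale t c p)) (regroup c a t (eval t p))
    where
    regroup : ∀ c a t x → c * a + t * (c * x) ≡ c * (a + t * x)
    regroup = solve-∀

  eval-⊗ : ∀ t p q → eval t (p ⊗ q) ≡ eval t p * eval t q
  eval-⊗ t []      q = sym (ℤ.*-zeroˡ (eval t q))
  eval-⊗ t (a ∷ p) q = begin
    eval t (scale a q ⊕ shift (p ⊗ q))                  ≡⟨ eval-⊕ t (scale a q) (shift (p ⊗ q)) ⟩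
    eval t (scale a q) + (+ 0 + t * eval t (p ⊗ q))     ≡⟨ cong₂ (λ u v → u + (+ 0 + t * v)) (eval-scale t a q) (eval-⊗ t p q) ⟩
    a * eval t q + (+ 0 + t * (eval t p * eval t q))    ≡⟨ regroup a t (eval t q) (eval t p) ⟩
    (a + t * eval t p) * eval t q                       ∎
    where
    open ≡-Reasoning
    regroup : ∀ a t y x → a * y + (+ 0 + t * (x * y)) ≡ (a + t * x) * y
    regroup = solve-∀

  eval-neg : ∀ t p → eval t (neg p) ≡ - eval t p
  eval-neg t []      = refl
  eval-neg t (a ∷ p) = trans (cong (λ v → - a + t * v) (eval-neg t p)) (regroup a t (eval t p))
    where
    regroup : ∀ a t x → - a + t * (- x) ≡ - (a + t * x)
    regroup = solve-∀

  eval-const : ∀ t a → eval t (const a) ≡ a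
  eval-const t a = trans (cong (_+_ a) (ℤ.*-zeroʳ t)) (ℤ.+-identityʳ a)

  eval-X : ∀ t → eval t X ≡ t
  eval-X = simplify
    where
    simplify : ∀ t → + 0 + t * (+ 1 + t * + 0) ≡ t
    simplify = solve-∀

  eval-≋[] : ∀ t {p} → p ≋ [] → eval t p ≡ + 0
  eval-≋[] t {[]}    _       = refl
  eval-≋[] t {a ∷ p} (mk≋ e) = begin
    a + t * eval t p      ≡⟨ cong₂ (λ u v → u + t * v) (e 0) (eval-≋[] t {p} (mk≋ λ k → e (suc k))) ⟩
    + 0 + t * + 0         ≡⟨ cong (_+_ (+ 0)) (ℤ.*-zeroʳ t) ⟩
    + 0                   ∎
    where open ≡-Reasoning

  eval-cong : ∀ t {p q} → p ≋ q → eval t p ≡ eval t q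
  eval-cong t {[]}    {q}     e       = sym (eval-≋[] t (≋-sym e))
  eval-cong t {a ∷ p} {[]}    e       = eval-≋[] t e
  eval-cong t {a ∷ p} {b ∷ q} (mk≋ e) = cong₂ (λ u v → u + t * v) (e 0) (eval-cong t {p} {q} (mk≋ λ k → e (suc k)))

  eval-^ : ∀ t p n → eval t (p ^ n) ≡ eval t p ℤ.^ n
  eval-^ t p zero    = eval-const t (+ 1)
  eval-^ t p (suc n) = trans (eval-⊗ t p (p ^ n)) (cong (eval t p *_) (eval-^ t p n))

  eval-∣ : ∀ t {g p} → g ∣ p → eval t g ℤ.∣ eval t p
  eval-∣ t {g} {p} (divides h e) = divides ℤ.∣ eval t h ∣ (begin
    ℤ.∣ eval t p ∣                    ≡⟨ cong ℤ.∣_∣ (eval-cong t e) ⟨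
    ℤ.∣ eval t (g ⊗ h) ∣              ≡⟨ cong ℤ.∣_∣ (trans (eval-⊗ t g h) (ℤ.*-comm (eval t g) (eval t h))) ⟩
    ℤ.∣ eval t h * eval t g ∣         ≡⟨ ℤ.abs-* (eval t h) (eval t g) ⟩
    ℤ.∣ eval t h ∣ ℕ.* ℤ.∣ eval t g ∣ ∎)
    where open ≡-Reasoning

  eval-≈ : ∀ t {g p q} → eval t g ≡ + 0 → Congruence._≈_ g p q → eval t p ≡ eval t q
  eval-≈ t {g} {p} {q} g[t]≡0 (Congruence.mk≈ (divides h gh≋p-q)) = ℤ.i-j≡0⇒i≡j (eval t p) (eval t q) (begin
    eval t p + - eval t q          ≡⟨ cong (_+_ (eval t p)) (eval-neg t q) ⟨
    eval t p + eval t (neg q)      ≡⟨ eval-⊕ t p (neg q) ⟨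
    eval t (p ⊕ neg q)             ≡⟨ eval-cong t gh≋p-q ⟨
    eval t (g ⊗ h)                 ≡⟨ eval-⊗ t g h ⟩
    eval t g * eval t h            ≡⟨ cong (_* eval t h) g[t]≡0 ⟩
    + 0 * eval t h                 ≡⟨ ℤ.*-zeroˡ (eval t h) ⟩
    + 0                            ∎)
    where open ≡-Reasoning

module FactorTheorem where

  open import Data.Integer as ℤ using (ℤ; +_; -_)
  import Data.Integer.Properties as ℤ
  open import Data.Integer.Tactic.RingSolver using (solve-∀)
  open import Data.List using ([]; _∷_)
  open import Data.Nat using (zero; suc)
  open import Data.Product using (Σ-syntax; _,_)
  open import Relation.Binary.PropositionalEquality
  import Relation.Binary.Reasoning.Setoid as SetoidReasoning
  open Polynomial
  open Divisibility
  open Evaluation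
  open ℤ[X]-Solver using (solve; _:=_; _:+_; _:*_; _:-_; con)

  -- π = 1 − X; modulo Φ_{q^k} it becomes the uniformiser 1 − ζ of ℤ[ζ].
  π : Poly
  π = + 1 ∷ - + 1 ∷ []

  π≋1-X : π ≋ 1P ⊕ neg X
  π≋1-X = mk≋ λ { zero → refl ; (suc zero) → refl ; (suc (suc k)) → refl }

  X⊗≋shift : ∀ p → X ⊗ p ≋ shift p
  X⊗≋shift p = ≋-trans (shift-⊗ 1P p) (shift-cong (⊗-identityˡ p))

  ∷≋const⊕X⊗ : ∀ a p → a ∷ p ≋ const a ⊕ X ⊗ p
  ∷≋const⊕X⊗ a p = ≋-trans {q = const a ⊕ shift p} (mk≋ λ { zero → sym (ℤ.+-identityʳ a) ; (suc k) → refl })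
                           (⊕-congˡ (const a) (≋-sym (X⊗≋shift p)))

  factor-at-1 : ∀ p → Σ[ h ∈ Poly ] p ≋ const (eval (+ 1) p) ⊕ π ⊗ h
  factor-at-1 []      = [] , ≋-sym (⊕-cong const-0 (⊗-zeroʳ π))
  factor-at-1 (a ∷ p) with factor-at-1 p
  ... | h , p≋ = h′ , (begin
    a ∷ p                                           ≈⟨ ∷≋const⊕X⊗ a p ⟩
    const a ⊕ X ⊗ p                                 ≈⟨ ⊕-congˡ (const a) (⊗-cong X≋1-π p≋) ⟩
    const a ⊕ (1P ⊕ neg π) ⊗ (const p₁ ⊕ π ⊗ h)     ≈⟨ expand (const a) (const p₁) π h ⟩
    (const a ⊕ const p₁) ⊕ π ⊗ h′                   ≈⟨ ⊕-congʳ (π ⊗ h′) const-sum ⟩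
    const (eval (+ 1) (a ∷ p)) ⊕ π ⊗ h′             ∎)
    where
    open SetoidReasoning ≋-setoid
    p₁ : ℤ
    p₁ = eval (+ 1) p
    h′ : Poly
    h′ = (h ⊕ neg (const p₁)) ⊕ neg (π ⊗ h)
    X≋1-π : X ≋ 1P ⊕ neg π
    X≋1-π = mk≋ λ { zero → refl ; (suc zero) → refl ; (suc (suc k)) → refl }
    expand : ∀ a e π h → a ⊕ (1P ⊕ neg π) ⊗ (e ⊕ π ⊗ h) ≋ (a ⊕ e) ⊕ π ⊗ ((h ⊕ neg e) ⊕ neg (π ⊗ h))
    expand = solve 4 (λ a e π h → a :+ (con (+ 1) :- π) :* (e :+ π :* h) := (a :+ e) :+ π :* ((h :- e) :- π :* h)) ≋-refl
    const-sum : const a ⊕ const p₁ ≋ const (eval (+ 1) (a ∷ p))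
    const-sum = mk≋ λ { zero → cong (ℤ._+_ a) (sym (ℤ.*-identityˡ p₁)) ; (suc k) → refl }

  root-1⇒π∣ : ∀ {p} → eval (+ 1) p ≡ + 0 → π ∣ p
  root-1⇒π∣ {p} p₁≡0 with factor-at-1 p
  ... | h , p≋ = divides h (≋-sym (≋-trans p≋ (⊕-congʳ (π ⊗ h) (≋-trans (≋-reflexive (cong const p₁≡0)) const-0))))

  coeff-π⊗ : ∀ p k → coeff (π ⊗ p) (suc k) ≡ coeff p (suc k) ℤ.- coeff p k
  coeff-π⊗ p k = begin
    coeff (π ⊗ p) (suc k)                                      ≡⟨ coeff-∷-⊗ (+ 1) (- + 1 ∷ []) p (suc k) ⟩
    + 1 ℤ.* coeff p (suc k) ℤ.+ coeff ((- + 1 ∷ []) ⊗ p) k      ≡⟨ cong (ℤ._+_ (+ 1 ℤ.* coeff p (suc k))) (coeff-∷-⊗ (- + 1) [] p k) ⟩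
    + 1 ℤ.* coeff p (suc k) ℤ.+ (- + 1 ℤ.* coeff p k ℤ.+ coeff (shift []) k) ≡⟨ cong (λ z → + 1 ℤ.* coeff p (suc k) ℤ.+ (- + 1 ℤ.* coeff p k ℤ.+ z)) (shift[] k) ⟩
    + 1 ℤ.* coeff p (suc k) ℤ.+ (- + 1 ℤ.* coeff p k ℤ.+ + 0)   ≡⟨ simplify (coeff p (suc k)) (coeff p k) ⟩
    coeff p (suc k) ℤ.- coeff p k                              ∎
    where
    open ≡-Reasoning
    shift[] : ∀ k → coeff (shift []) k ≡ + 0
    shift[] zero    = refl
    shift[] (suc k) = refl
    simplify : ∀ x y → + 1 ℤ.* x ℤ.+ (- + 1 ℤ.* y ℤ.+ + 0) ≡ x ℤ.- y
    simplify = solve-∀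

  coeff-π⊗-zero : ∀ p → coeff (π ⊗ p) 0 ≡ coeff p 0
  coeff-π⊗-zero p = trans (coeff-∷-⊗ (+ 1) (- + 1 ∷ []) p 0)
                          (trans (ℤ.+-identityʳ (+ 1 ℤ.* coeff p 0)) (ℤ.*-identityˡ (coeff p 0)))

  π⊗≋[]⇒≋[] : ∀ {p} → π ⊗ p ≋ [] → p ≋ []
  π⊗≋[]⇒≋[] {p} (mk≋ e) = mk≋ vanish
    where
    vanish : ∀ k → coeff p k ≡ + 0
    vanish zero    = trans (sym (coeff-π⊗-zero p)) (e 0)
    vanish (suc k) = trans (ℤ.i-j≡0⇒i≡j _ _ (trans (sym (coeff-π⊗ p k)) (e (suc k)))) (vanish k)

  π⊗-cancel : ∀ {p q} → π ⊗ p ≋ π ⊗ q → p ≋ q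
  π⊗-cancel {p} {q} πp≋πq = ⊕-neg≋[]⇒≋ (π⊗≋[]⇒≋[] (≋-trans (distribute π p q) (≋-trans (⊕-congʳ (neg (π ⊗ q)) πp≋πq) (⊕-inverseʳ (π ⊗ q)))))
    where
    distribute : ∀ π p q → π ⊗ (p ⊕ neg q) ≋ π ⊗ p ⊕ neg (π ⊗ q)
    distribute = solve 3 (λ π p q → π :* (p :- q) := π :* p :- π :* q) ≋-refl

module GeometricSums where

  open import Algebra.Bundles using (module CommutativeRing)
  import Algebra.Properties.Semiring.Exp as Exp
  open import Data.Integer as ℤ using (+_)
  import Data.Integer.Properties as ℤ
  open import Data.List using ([]; foldr; applyUpTo)
  open import Data.Nat as ℕ using (ℕ; zero; suc)
  import Data.Nat.Properties as ℕ
  open import Relation.Binary.PropositionalEquality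
  import Relation.Binary.Reasoning.Setoid as SetoidReasoning
  open Polynomial
  open Evaluation
  open FactorTheorem
  open ℤ[X]-Solver using (solve; _:=_; _:+_; _:*_; _:-_; con)
  open Exp (CommutativeRing.semiring ℤ[X]) using (^-homo-*; ^-assocʳ; ^-congʳ)

  geometric : Poly → ℕ → Poly
  geometric y zero    = []
  geometric y (suc m) = 1P ⊕ y ⊗ geometric y m

  geometric-1 : ∀ y → geometric y 1 ≋ 1P
  geometric-1 y = ≋-trans (⊕-congˡ 1P (⊗-zeroʳ y)) (⊕-identityʳ 1P)

  geometric-cong : ∀ {y y′} m → y ≋ y′ → geometric y m ≋ geometric y′ m
  geometric-cong zero    _    = ≋-refl
  geometric-cong (suc m) y≋y′ = ⊕-congˡ 1P (⊗-cong y≋y′ (geometric-cong m y≋y′))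

  [1-y]⊗geometric : ∀ y m → (1P ⊕ neg y) ⊗ geometric y m ≋ 1P ⊕ neg (y ^ m)
  [1-y]⊗geometric y zero    = ≋-trans (⊗-zeroʳ (1P ⊕ neg y)) (≋-sym (⊕-inverseʳ 1P))
  [1-y]⊗geometric y (suc m) = begin
    (1P ⊕ neg y) ⊗ (1P ⊕ y ⊗ geometric y m)                 ≈⟨ expand y (geometric y m) ⟩
    (1P ⊕ neg y) ⊕ y ⊗ ((1P ⊕ neg y) ⊗ geometric y m)       ≈⟨ ⊕-congˡ (1P ⊕ neg y) (⊗-congˡ y ([1-y]⊗geometric y m)) ⟩
    (1P ⊕ neg y) ⊕ y ⊗ (1P ⊕ neg (y ^ m))                   ≈⟨ collapse y (y ^ m) ⟩
    1P ⊕ neg (y ⊗ y ^ m)                                    ∎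
    where
    open SetoidReasoning ≋-setoid
    expand : ∀ y g → (1P ⊕ neg y) ⊗ (1P ⊕ y ⊗ g) ≋ (1P ⊕ neg y) ⊕ y ⊗ ((1P ⊕ neg y) ⊗ g)
    expand = solve 2 (λ y g → (con (+ 1) :- y) :* (con (+ 1) :+ y :* g) := (con (+ 1) :- y) :+ y :* ((con (+ 1) :- y) :* g)) ≋-refl
    collapse : ∀ y p → (1P ⊕ neg y) ⊕ y ⊗ (1P ⊕ neg p) ≋ 1P ⊕ neg (y ⊗ p)
    collapse = solve 2 (λ y p → (con (+ 1) :- y) :+ y :* (con (+ 1) :- p) := con (+ 1) :- y :* p) ≋-refl

  π⊗geometric : ∀ m → π ⊗ geometric X m ≋ 1P ⊕ neg (X ^ m)
  π⊗geometric m = ≋-trans (⊗-congʳ (geometric X m) π≋1-X) ([1-y]⊗geometric X m)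

  geometric-⊗ : ∀ a b → geometric X a ⊗ geometric (X ^ a) b ≋ geometric X (a ℕ.* b)
  geometric-⊗ a b = π⊗-cancel (begin
    π ⊗ (geometric X a ⊗ geometric (X ^ a) b)      ≈⟨ ⊗-assoc π (geometric X a) (geometric (X ^ a) b) ⟨
    (π ⊗ geometric X a) ⊗ geometric (X ^ a) b      ≈⟨ ⊗-congʳ (geometric (X ^ a) b) (π⊗geometric a) ⟩
    (1P ⊕ neg (X ^ a)) ⊗ geometric (X ^ a) b       ≈⟨ [1-y]⊗geometric (X ^ a) b ⟩
    1P ⊕ neg ((X ^ a) ^ b)                         ≈⟨ ⊕-congˡ 1P (neg-cong (^-assocʳ X a b)) ⟩
    1P ⊕ neg (X ^ (a ℕ.* b))                       ≈⟨ π⊗geometric (a ℕ.* b) ⟨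
    π ⊗ geometric X (a ℕ.* b)                      ∎)
    where open SetoidReasoning ≋-setoid

  eval-geometric : ∀ {y} m → eval (+ 1) y ≡ + 1 → eval (+ 1) (geometric y m) ≡ + m
  eval-geometric         zero    _    = refl
  eval-geometric {y} (suc m) y₁≡1 = begin
    eval (+ 1) (1P ⊕ y ⊗ geometric y m)                  ≡⟨ eval-⊕ (+ 1) 1P (y ⊗ geometric y m) ⟩
    + 1 ℤ.+ eval (+ 1) (y ⊗ geometric y m)               ≡⟨ cong (ℤ._+_ (+ 1)) (eval-⊗ (+ 1) y (geometric y m)) ⟩
    + 1 ℤ.+ eval (+ 1) y ℤ.* eval (+ 1) (geometric y m)  ≡⟨ cong₂ (λ u v → + 1 ℤ.+ u ℤ.* v) y₁≡1 (eval-geometric m y₁≡1) ⟩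
    + 1 ℤ.+ + 1 ℤ.* + m                                  ≡⟨ cong (ℤ._+_ (+ 1)) (ℤ.*-identityˡ (+ m)) ⟩
    + suc m                                              ∎
    where open ≡-Reasoning

  eval-X^ : ∀ n → eval (+ 1) (X ^ n) ≡ + 1
  eval-X^ n = trans (eval-^ (+ 1) X n) (ℤ.^-zeroˡ n)

  monomial≋X^ : ∀ n → monomial n ≋ X ^ n
  monomial≋X^ zero    = ≋-refl
  monomial≋X^ (suc n) = ≋-trans (shift-cong (monomial≋X^ n)) (≋-sym (X⊗≋shift (X ^ n)))

  Φpp≋geometric : ∀ q b → Φpp q b ≋ geometric (X ^ (q ℕ.^ b)) q
  Φpp≋geometric q b = ≋-trans (progression q (λ i → i) 0 (λ _ → refl)) (⊗-identityˡ _)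
    where
    n : ℕ
    n = q ℕ.^ b
    progression : ∀ m f k → (∀ i → f i ≡ k ℕ.+ i) →
      foldr (λ j acc → monomial (j ℕ.* n) ⊕ acc) [] (applyUpTo f m) ≋ X ^ (k ℕ.* n) ⊗ geometric (X ^ n) m
    progression zero    f k f≡ = ≋-sym (⊗-zeroʳ (X ^ (k ℕ.* n)))
    progression (suc m) f k f≡ = begin
      monomial (f 0 ℕ.* n) ⊕ foldr (λ j acc → monomial (j ℕ.* n) ⊕ acc) [] (applyUpTo (λ i → f (suc i)) m)
        ≈⟨ ⊕-cong first (progression m (λ i → f (suc i)) (suc k) (λ i → trans (f≡ (suc i)) (ℕ.+-suc k i))) ⟩
      X ^ (k ℕ.* n) ⊕ X ^ (n ℕ.+ k ℕ.* n) ⊗ geometric (X ^ n) m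
        ≈⟨ ⊕-congˡ (X ^ (k ℕ.* n)) (⊗-congʳ (geometric (X ^ n) m) (≋-trans (^-homo-* X n (k ℕ.* n)) (⊗-comm (X ^ n) (X ^ (k ℕ.* n))))) ⟩
      X ^ (k ℕ.* n) ⊕ (X ^ (k ℕ.* n) ⊗ X ^ n) ⊗ geometric (X ^ n) m
        ≈⟨ factor (X ^ (k ℕ.* n)) (X ^ n) (geometric (X ^ n) m) ⟩
      X ^ (k ℕ.* n) ⊗ (1P ⊕ X ^ n ⊗ geometric (X ^ n) m)  ∎
      where
      open SetoidReasoning ≋-setoid
      first : monomial (f 0 ℕ.* n) ≋ X ^ (k ℕ.* n)
      first = ≋-trans (monomial≋X^ (f 0 ℕ.* n)) (^-congʳ X (cong (ℕ._* n) (trans (f≡ 0) (ℕ.+-identityʳ k))))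
      factor : ∀ a y g → a ⊕ (a ⊗ y) ⊗ g ≋ a ⊗ (1P ⊕ y ⊗ g)
      factor = solve 3 (λ a y g → a :+ (a :* y) :* g := a :* (con (+ 1) :+ y :* g)) ≋-refl

module Masks where

  open import Algebra.Bundles using (module CommutativeRing)
  import Algebra.Properties.Semiring.Exp as Exp
  open import Data.Integer as ℤ using (+_)
  open import Data.List using (List; []; _∷_; _++_; map; length; applyUpTo; upTo; cartesianProductWith)
  open import Data.List.Relation.Binary.Permutation.Propositional as ↭ using (_↭_)
  open import Data.Nat as ℕ using (ℕ; zero; suc; _+_)
  import Data.Nat.Properties as ℕ
  open import Relation.Binary.PropositionalEquality
  import Relation.Binary.Reasoning.Setoid as SetoidReasoning
  open Polynomial
  open Evaluation
  open GeometricSums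
  open ℤ[X]-Solver using (solve; _:=_; _:+_; _:*_; con)
  open Exp (CommutativeRing.semiring ℤ[X]) using (^-homo-*; ^-congʳ)

  mask-++ : ∀ xs ys → mask (xs ++ ys) ≋ mask xs ⊕ mask ys
  mask-++ []       ys = ≋-refl
  mask-++ (x ∷ xs) ys = ≋-trans (⊕-congˡ (monomial x) (mask-++ xs ys)) (≋-sym (⊕-assoc (monomial x) (mask xs) (mask ys)))

  mask-↭ : ∀ {xs ys} → xs ↭ ys → mask xs ≋ mask ys
  mask-↭ ↭.refl          = ≋-refl
  mask-↭ (↭.prep x p)    = ⊕-congˡ (monomial x) (mask-↭ p)
  mask-↭ (↭.swap {xs} {ys} x y p) = begin
    monomial x ⊕ (monomial y ⊕ mask xs)   ≈⟨ ⊕-assoc (monomial x) (monomial y) (mask xs) ⟨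
    (monomial x ⊕ monomial y) ⊕ mask xs   ≈⟨ ⊕-cong (⊕-comm (monomial x) (monomial y)) (mask-↭ p) ⟩
    (monomial y ⊕ monomial x) ⊕ mask ys   ≈⟨ ⊕-assoc (monomial y) (monomial x) (mask ys) ⟩
    monomial y ⊕ (monomial x ⊕ mask ys)   ∎
    where open SetoidReasoning ≋-setoid
  mask-↭ (↭.trans p p′)  = ≋-trans (mask-↭ p) (mask-↭ p′)

  monomial-+ : ∀ a b → monomial (a + b) ≋ monomial a ⊗ monomial b
  monomial-+ a b = begin
    monomial (a + b)          ≈⟨ monomial≋X^ (a + b) ⟩
    X ^ (a + b)               ≈⟨ ^-homo-* X a b ⟩
    X ^ a ⊗ X ^ b             ≈⟨ ⊗-cong (monomial≋X^ a) (monomial≋X^ b) ⟨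
    monomial a ⊗ monomial b   ∎
    where open SetoidReasoning ≋-setoid

  monomial⊗mask : ∀ a ys → monomial a ⊗ mask ys ≋ mask (map (_+_ a) ys)
  monomial⊗mask a []       = ⊗-zeroʳ (monomial a)
  monomial⊗mask a (y ∷ ys) = ≋-trans (⊗-distribˡ (monomial a) (monomial y) (mask ys))
                                    (⊕-cong (≋-sym (monomial-+ a y)) (monomial⊗mask a ys))

  mask-⊗ : ∀ xs ys → mask xs ⊗ mask ys ≋ mask (cartesianProductWith _+_ xs ys)
  mask-⊗ []       ys = ≋-refl
  mask-⊗ (x ∷ xs) ys = begin
    (monomial x ⊕ mask xs) ⊗ mask ys                                     ≈⟨ ⊗-distribʳ (monomial x) (mask xs) (mask ys) ⟩
    monomial x ⊗ mask ys ⊕ mask xs ⊗ mask ys                             ≈⟨ ⊕-cong (monomial⊗mask x ys) (mask-⊗ xs ys) ⟩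
    mask (map (_+_ x) ys) ⊕ mask (cartesianProductWith _+_ xs ys)         ≈⟨ mask-++ (map (_+_ x) ys) (cartesianProductWith _+_ xs ys) ⟨
    mask (map (_+_ x) ys ++ cartesianProductWith _+_ xs ys)               ∎
    where open SetoidReasoning ≋-setoid

  eval-monomial : ∀ n → eval (+ 1) (monomial n) ≡ + 1
  eval-monomial n = trans (eval-cong (+ 1) (monomial≋X^ n)) (eval-X^ n)

  eval-mask : ∀ xs → eval (+ 1) (mask xs) ≡ + length xs
  eval-mask []       = refl
  eval-mask (x ∷ xs) = trans (eval-⊕ (+ 1) (monomial x) (mask xs)) (cong₂ ℤ._+_ (eval-monomial x) (eval-mask xs))

  mask-upTo : ∀ m → mask (upTo m) ≋ geometric X m
  mask-upTo m = ≋-trans (progression m (λ i → i) 0 (λ _ → refl)) (⊗-identityˡ (geometric X m))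
    where
    progression : ∀ m f k → (∀ i → f i ≡ k + i) → mask (applyUpTo f m) ≋ X ^ k ⊗ geometric X m
    progression zero    f k f≡ = ≋-sym (⊗-zeroʳ (X ^ k))
    progression (suc m) f k f≡ = begin
      monomial (f 0) ⊕ mask (applyUpTo (λ i → f (suc i)) m)  ≈⟨ ⊕-cong first (progression m (λ i → f (suc i)) (suc k) (λ i → trans (f≡ (suc i)) (ℕ.+-suc k i))) ⟩
      X ^ k ⊕ (X ⊗ X ^ k) ⊗ geometric X m                    ≈⟨ factor (X ^ k) X (geometric X m) ⟩
      X ^ k ⊗ (1P ⊕ X ⊗ geometric X m)                       ∎
      where
      open SetoidReasoning ≋-setoid
      first : monomial (f 0) ≋ X ^ k
      first = ≋-trans (monomial≋X^ (f 0)) (^-congʳ X (trans (f≡ 0) (ℕ.+-identityʳ k)))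
      factor : ∀ a y g → a ⊕ (y ⊗ a) ⊗ g ≋ a ⊗ (1P ⊕ y ⊗ g)
      factor = solve 3 (λ a y g → a :+ (y :* a) :* g := a :* (con (+ 1) :+ y :* g)) ≋-refl

module MasksModulo (M : ℕ) .{{_ : NonZero M}} where

  open import Algebra.Bundles using (module CommutativeRing)
  import Algebra.Properties.Semiring.Exp as Exp
  open import Data.Integer using (+_; -_)
  open import Data.List using (List; []; _∷_; _++_; map; cartesianProductWith)
  open import Data.Nat as ℕ using (ℕ; _+_; _*_)
  open import Data.Nat.DivMod using (_%_; _/_; m≡m%n+[m/n]*n)
  open import Relation.Binary.PropositionalEquality using (_≡_)
  import Relation.Binary.Reasoning.Setoid as SetoidReasoning
  open Polynomial
  open Divisibility using (divides)
  open GeometricSums using (monomial≋X^)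
  open Masks
  open ℤ[X]-Solver using (solve; _:=_; _:*_; _:-_; :-_; con)
  open Exp (CommutativeRing.semiring ℤ[X]) using (^-homo-*; ^-congʳ)
  open Congruence (1P ⊕ neg (X ^ M))

  X^M≈1 : X ^ M ≈ 1P
  X^M≈1 = mk≈ (divides (neg 1P) (negate (X ^ M)))
    where
    negate : ∀ y → (1P ⊕ neg y) ⊗ neg 1P ≋ y ⊕ neg 1P
    negate = solve 1 (λ y → (con (+ 1) :- y) :* (:- con (+ 1)) := y :- con (+ 1)) ≋-refl

  X^[k*M]≈1 : ∀ k → X ^ (k * M) ≈ 1P
  X^[k*M]≈1 ℕ.zero    = ≈-refl
  X^[k*M]≈1 (ℕ.suc k) = begin
    X ^ (M + k * M)         ≈⟨ ≋⇒≈ (^-homo-* X M (k * M)) ⟩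
    X ^ M ⊗ X ^ (k * M)     ≈⟨ ⊗-cong≈ X^M≈1 (X^[k*M]≈1 k) ⟩
    1P ⊗ 1P                 ≈⟨ ≋⇒≈ (⊗-identityˡ 1P) ⟩
    1P                      ∎
    where open SetoidReasoning ≈-setoid

  monomial≈monomial-% : ∀ m → monomial m ≈ monomial (m % M)
  monomial≈monomial-% m = begin
    monomial m                            ≈⟨ ≋⇒≈ (monomial≋X^ m) ⟩
    X ^ m                                 ≈⟨ ≋⇒≈ (^-congʳ X (m≡m%n+[m/n]*n m M)) ⟩
    X ^ (m % M + m / M * M)               ≈⟨ ≋⇒≈ (^-homo-* X (m % M) (m / M * M)) ⟩
    X ^ (m % M) ⊗ X ^ (m / M * M)         ≈⟨ ⊗-cong≈ (≈-refl {X ^ (m % M)}) (X^[k*M]≈1 (m / M)) ⟩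
    X ^ (m % M) ⊗ 1P                      ≈⟨ ≋⇒≈ (≋-trans (⊗-identityʳ (X ^ (m % M))) (≋-sym (monomial≋X^ (m % M)))) ⟩
    monomial (m % M)                      ∎
    where open SetoidReasoning ≈-setoid

  mask-map-cong≈ : ∀ {f g : ℕ → ℕ} ys → (∀ y → monomial (f y) ≈ monomial (g y)) → mask (map f ys) ≈ mask (map g ys)
  mask-map-cong≈ []       f≈g = ≈-refl
  mask-map-cong≈ (y ∷ ys) f≈g = ⊕-cong≈ (f≈g y) (mask-map-cong≈ ys f≈g)

  mask-⊗≈ : ∀ xs ys → mask xs ⊗ mask ys ≈ mask (cartesianProductWith (λ a b → (a + b) % M) xs ys)
  mask-⊗≈ []       ys = ≈-refl
  mask-⊗≈ (x ∷ xs) ys = begin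
    (monomial x ⊕ mask xs) ⊗ mask ys                         ≈⟨ ≋⇒≈ (⊗-distribʳ (monomial x) (mask xs) (mask ys)) ⟩
    monomial x ⊗ mask ys ⊕ mask xs ⊗ mask ys                 ≈⟨ ⊕-cong≈ (≋⇒≈ (monomial⊗mask x ys)) (mask-⊗≈ xs ys) ⟩
    mask (map (_+_ x) ys) ⊕ mask rest                        ≈⟨ ⊕-cong≈ (mask-map-cong≈ ys (λ y → monomial≈monomial-% (x + y))) (≈-refl {mask rest}) ⟩
    mask (map (λ b → (x + b) % M) ys) ⊕ mask rest            ≈⟨ ≋⇒≈ (mask-++ (map (λ b → (x + b) % M) ys) rest) ⟨
    mask (map (λ b → (x + b) % M) ys ++ rest)                ∎
    where
    open SetoidReasoning ≈-setoid
    rest : List ℕ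
    rest = cartesianProductWith (λ a b → (a + b) % M) xs ys

module Degree where

  open import Data.Integer as ℤ using (ℤ; +_; -_; _+_; _*_)
  import Data.Integer.Properties as ℤ
  open import Data.List using ([]; _∷_; length)
  open import Data.Nat as ℕ using (ℕ; zero; suc; _≤_; _<_; s≤s; z≤n)
  import Data.Nat.Properties as ℕ
  open import Relation.Binary.PropositionalEquality
  open Polynomial

  Deg< : ℕ → Poly → Set
  Deg< n p = ∀ k → n ≤ k → coeff p k ≡ + 0

  Deg<-cong : ∀ {n p q} → p ≋ q → Deg< n p → Deg< n q
  Deg<-cong (mk≋ e) h k n≤k = trans (sym (e k)) (h k n≤k)

  Deg<-mono : ∀ {m n} p → m ≤ n → Deg< m p → Deg< n p
  Deg<-mono p m≤n h k n≤k = h k (ℕ.≤-trans m≤n n≤k)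

  Deg<-⊕ : ∀ {n} p q → Deg< n p → Deg< n q → Deg< n (p ⊕ q)
  Deg<-⊕ p q hp hq k n≤k = trans (coeff-⊕ p q k) (cong₂ _+_ (hp k n≤k) (hq k n≤k))

  Deg<-neg : ∀ {n} p → Deg< n p → Deg< n (neg p)
  Deg<-neg p h k n≤k = trans (coeff-neg p k) (cong -_ (h k n≤k))

  Deg<-scale : ∀ {n} c p → Deg< n p → Deg< n (scale c p)
  Deg<-scale c p h k n≤k = trans (coeff-scale c p k) (trans (cong (c *_) (h k n≤k)) (ℤ.*-zeroʳ c))

  Deg<-const : ∀ a → Deg< 1 (const a)
  Deg<-const a (suc k) _ = refl

  Deg<-length : ∀ p → Deg< (length p) p
  Deg<-length []      k       _         = refl
  Deg<-length (a ∷ p) (suc k) (s≤s n≤k) = Deg<-length p k n≤k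

  coeff-⊗-top : ∀ p q m n → Deg< (suc m) p → Deg< (suc n) q → coeff (p ⊗ q) (m ℕ.+ n) ≡ coeff p m * coeff q n
  coeff-⊗-top []      q m       n       hp hq = sym (ℤ.*-zeroˡ (coeff q n))
  coeff-⊗-top (a ∷ p) q zero    zero    hp hq = trans (coeff-∷-⊗ a p q 0) (ℤ.+-identityʳ (a * coeff q 0))
  coeff-⊗-top (a ∷ p) q zero    (suc n) hp hq = begin
    coeff ((a ∷ p) ⊗ q) (suc n)               ≡⟨ coeff-∷-⊗ a p q (suc n) ⟩
    a * coeff q (suc n) + coeff (p ⊗ q) n     ≡⟨ cong (_+_ (a * coeff q (suc n))) (coeff-≡ (⊗-zeroˡ {p} q (mk≋ λ k → hp (suc k) (s≤s z≤n))) n) ⟩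
    a * coeff q (suc n) + + 0                 ≡⟨ ℤ.+-identityʳ (a * coeff q (suc n)) ⟩
    a * coeff q (suc n)                       ∎
    where open ≡-Reasoning
  coeff-⊗-top (a ∷ p) q (suc m) n hp hq = begin
    coeff ((a ∷ p) ⊗ q) (suc (m ℕ.+ n))                     ≡⟨ coeff-∷-⊗ a p q (suc (m ℕ.+ n)) ⟩
    a * coeff q (suc (m ℕ.+ n)) + coeff (p ⊗ q) (m ℕ.+ n)   ≡⟨ cong (_+ coeff (p ⊗ q) (m ℕ.+ n)) (cong (a *_) (hq _ (s≤s (ℕ.m≤n+m n m)))) ⟩
    a * + 0 + coeff (p ⊗ q) (m ℕ.+ n)                       ≡⟨ cong (_+ coeff (p ⊗ q) (m ℕ.+ n)) (ℤ.*-zeroʳ a) ⟩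
    + 0 + coeff (p ⊗ q) (m ℕ.+ n)                           ≡⟨ ℤ.+-identityˡ _ ⟩
    coeff (p ⊗ q) (m ℕ.+ n)                                 ≡⟨ coeff-⊗-top p q m n (λ k m≤k → hp (suc k) (s≤s m≤k)) hq ⟩
    coeff p m * coeff q n                                   ∎
    where open ≡-Reasoning

  Deg<-shift : ∀ {n} p → Deg< n p → Deg< (suc n) (shift p)
  Deg<-shift p h (suc k) (s≤s n≤k) = h k n≤k

  Deg<-⊗ : ∀ p q m n → Deg< (suc m) p → Deg< (suc n) q → Deg< (suc (m ℕ.+ n)) (p ⊗ q)
  Deg<-⊗ []      q m n hp hq = λ _ _ → refl
  Deg<-⊗ (a ∷ p) q m n hp hq =
    Deg<-⊕ (scale a q) (shift (p ⊗ q)) (Deg<-scale a q (Deg<-mono q (s≤s (ℕ.m≤n+m n m)) hq)) (Deg<-shift (p ⊗ q) (tail m hp))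
    where
    tail : ∀ m → Deg< (suc m) (a ∷ p) → Deg< (m ℕ.+ n) (p ⊗ q)
    tail zero    hp k _ = coeff-≡ (⊗-zeroˡ {p} q (mk≋ λ j → hp (suc j) (s≤s z≤n))) k
    tail (suc m) hp     = Deg<-⊗ p q m n (λ j m<j → hp (suc j) (s≤s m<j)) hq

  record Monic (d : ℕ) (Φ : Poly) : Set where
    field
      degree< : Deg< (suc d) Φ
      leading : coeff Φ d ≡ + 1

module Reduction (Φ : Poly) {d′ : ℕ} (monic : Degree.Monic (suc d′) Φ) where

  open import Data.Integer as ℤ using (ℤ; +_; -_; _+_; _*_)
  import Data.Integer.Properties as ℤ
  open import Data.Integer.Tactic.RingSolver using (solve-∀)
  open import Data.List using ([]; _∷_; length)
  open import Data.Nat as ℕ using (ℕ; zero; suc; _≤_; _<_; s≤s; z≤n)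
  import Data.Nat.Properties as ℕ
  open import Data.Sum using (_⊎_; inj₁; inj₂)
  open import Relation.Binary.PropositionalEquality
  import Relation.Binary.Reasoning.Setoid as SetoidReasoning
  open Polynomial
  open Divisibility
  open Degree
  open Monic monic
  open FactorTheorem using (∷≋const⊕X⊗; X⊗≋shift)
  open Congruence Φ
  open ℤ[X]-Solver using (solve; _:=_; _:-_)

  d : ℕ
  d = suc d′

  private
    vanishing-quotient : ∀ n h → Deg< n h → Deg< d (Φ ⊗ h) → ∀ k → coeff h k ≡ + 0
    vanishing-quotient zero    h h<0 _   k = h<0 k z≤n
    vanishing-quotient (suc n) h h<1+n Φh<d = vanishing-quotient n h h<n Φh<d
      where
      top : coeff h n ≡ + 0
      top = begin
        coeff h n                      ≡⟨ ℤ.*-identityˡ (coeff h n) ⟨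
        + 1 * coeff h n                ≡⟨ cong (_* coeff h n) leading ⟨
        coeff Φ d * coeff h n          ≡⟨ coeff-⊗-top Φ h d n degree< h<1+n ⟨
        coeff (Φ ⊗ h) (d ℕ.+ n)        ≡⟨ Φh<d (d ℕ.+ n) (ℕ.m≤m+n d n) ⟩
        + 0                            ∎
        where open ≡-Reasoning
      h<n : Deg< n h
      h<n k n≤k with ℕ.m≤n⇒m<n∨m≡n n≤k
      ... | inj₁ n<k = h<1+n k n<k
      ... | inj₂ refl = top

  ∣∧Deg<⇒≋[] : ∀ {p} → Φ ∣ p → Deg< d p → p ≋ []
  ∣∧Deg<⇒≋[] {p} (divides h Φh≋p) p<d =
    ≋-trans (≋-sym Φh≋p) (≋-trans (⊗-congˡ Φ h≋[]) (⊗-zeroʳ Φ))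
    where
    h≋[] : h ≋ []
    h≋[] = mk≋ (vanishing-quotient (length h) h (Deg<-length h) (Deg<-cong (≋-sym Φh≋p) p<d))

  X⊗-reduced : Poly → Poly
  X⊗-reduced v = shift v ⊕ neg (scale (coeff v d′) Φ)

  reduce : Poly → Poly
  reduce []      = []
  reduce (a ∷ p) = const a ⊕ X⊗-reduced (reduce p)

  Deg<-X⊗-reduced : ∀ v → Deg< d v → Deg< d (X⊗-reduced v)
  Deg<-X⊗-reduced v v<d (suc k) (s≤s d′≤k) = begin
    coeff (shift v ⊕ neg (scale c Φ)) (suc k)      ≡⟨ coeff-⊕ (shift v) (neg (scale c Φ)) (suc k) ⟩
    coeff v k + coeff (neg (scale c Φ)) (suc k)    ≡⟨ cong (_+_ (coeff v k)) (trans (coeff-neg (scale c Φ) (suc k)) (cong -_ (coeff-scale c Φ (suc k)))) ⟩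
    coeff v k + - (c * coeff Φ (suc k))            ≡⟨ cancel k (ℕ.m≤n⇒m<n∨m≡n d′≤k) ⟩
    + 0                                            ∎
    where
    open ≡-Reasoning
    c : ℤ
    c = coeff v d′
    vanishes : ∀ c → + 0 + - (c * + 0) ≡ + 0
    vanishes = solve-∀
    cancels : ∀ c → c + - (c * + 1) ≡ + 0
    cancels = solve-∀
    cancel : ∀ k → d′ < k ⊎ d′ ≡ k → coeff v k + - (c * coeff Φ (suc k)) ≡ + 0
    cancel k (inj₁ d′<k) = trans (cong₂ (λ x y → x + - (c * y)) (v<d k d′<k) (degree< (suc k) (s≤s d′<k))) (vanishes c)
    cancel k (inj₂ refl) = trans (cong (λ y → c + - (c * y)) leading) (cancels c)

  Deg<-reduce : ∀ p → Deg< d (reduce p)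
  Deg<-reduce []      _ _ = refl
  Deg<-reduce (a ∷ p) = Deg<-⊕ (const a) (X⊗-reduced (reduce p))
    (Deg<-mono (const a) (s≤s z≤n) (Deg<-const a)) (Deg<-X⊗-reduced (reduce p) (Deg<-reduce p))

  shift≈X⊗-reduced : ∀ v → shift v ≈ X⊗-reduced v
  shift≈X⊗-reduced v = mk≈ (divides (const c) (begin
    Φ ⊗ const c                                      ≈⟨ ⊗-comm Φ (const c) ⟩
    const c ⊗ Φ                                      ≈⟨ const⊗≋scale c Φ ⟩
    scale c Φ                                        ≈⟨ cancel (shift v) (scale c Φ) ⟩
    shift v ⊕ neg (shift v ⊕ neg (scale c Φ))        ∎))
    where
    open SetoidReasoning ≋-setoid
    c : ℤ
    c = coeff v d′
    cancel : ∀ s t → t ≋ s ⊕ neg (s ⊕ neg t)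
    cancel = solve 2 (λ s t → t := s :- (s :- t)) ≋-refl

  ≈reduce : ∀ p → p ≈ reduce p
  ≈reduce []      = ≈-refl
  ≈reduce (a ∷ p) = begin
    a ∷ p                               ≈⟨ ≋⇒≈ (∷≋const⊕X⊗ a p) ⟩
    const a ⊕ X ⊗ p                     ≈⟨ ⊕-cong≈ (≈-refl {const a}) (⊗-cong≈ (≈-refl {X}) (≈reduce p)) ⟩
    const a ⊕ X ⊗ reduce p              ≈⟨ ≋⇒≈ (⊕-congˡ (const a) (X⊗≋shift (reduce p))) ⟩
    const a ⊕ shift (reduce p)          ≈⟨ ⊕-cong≈ (≈-refl {const a}) (shift≈X⊗-reduced (reduce p)) ⟩
    const a ⊕ X⊗-reduced (reduce p)     ∎
    where open SetoidReasoning ≈-setoid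

  reduced-≈⇒≋ : ∀ {p p′} → p ≈ p′ → Deg< d p → Deg< d p′ → p ≋ p′
  reduced-≈⇒≋ {p} {p′} (mk≈ Φ∣p-p′) p<d p′<d =
    ⊕-neg≋[]⇒≋ (∣∧Deg<⇒≋[] Φ∣p-p′ (Deg<-⊕ p (neg p′) p<d (Deg<-neg p′ p′<d)))

module PrimeBinomial where

  open import Data.Nat
  open import Data.Nat.Combinatorics
  open import Data.Nat.Divisibility
  open import Data.Nat.Primality
  open import Data.Nat.Properties
  open import Data.Nat.Tactic.RingSolver using (solve-∀)
  open import Data.Sum using (inj₁; inj₂)
  open import Relation.Binary.PropositionalEquality
  open import Relation.Nullary using (contradiction)

  [1+k]*[1+n]C[1+k]≡[1+n]*nCk : ∀ n k → suc k * (suc n C suc k) ≡ suc n * (n C k)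
  [1+k]*[1+n]C[1+k]≡[1+n]*nCk zero    zero    = refl
  [1+k]*[1+n]C[1+k]≡[1+n]*nCk zero    (suc k) = *-zeroʳ (suc (suc k))
  [1+k]*[1+n]C[1+k]≡[1+n]*nCk (suc m) zero    = trans (*-identityˡ _) (trans (nC1≡n (suc (suc m))) (sym (*-identityʳ _)))
  [1+k]*[1+n]C[1+k]≡[1+n]*nCk (suc m) (suc k) = begin
    suc (suc k) * (suc (suc m) C suc (suc k))
      ≡⟨ cong (suc (suc k) *_) (nCk+nC[k+1]≡[n+1]C[k+1] (suc m) (suc k)) ⟨
    suc (suc k) * (suc m C suc k + suc m C suc (suc k))
      ≡⟨ expand (suc m C suc k) (suc m C suc (suc k)) k ⟩
    suc m C suc k + suc k * (suc m C suc k) + suc (suc k) * (suc m C suc (suc k))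
      ≡⟨ cong₂ (λ u v → suc m C suc k + u + v) ([1+k]*[1+n]C[1+k]≡[1+n]*nCk m k) ([1+k]*[1+n]C[1+k]≡[1+n]*nCk m (suc k)) ⟩
    suc m C suc k + suc m * (m C k) + suc m * (m C suc k)
      ≡⟨ factor (suc m C suc k) (suc m) (m C k) (m C suc k) ⟩
    suc m C suc k + suc m * (m C k + m C suc k)
      ≡⟨ cong (λ u → suc m C suc k + suc m * u) (nCk+nC[k+1]≡[n+1]C[k+1] m k) ⟩
    suc m C suc k + suc m * (suc m C suc k)
      ∎
    where
    open ≡-Reasoning
    expand : ∀ a b k → suc (suc k) * (a + b) ≡ a + suc k * a + suc (suc k) * b
    expand = solve-∀
    factor : ∀ a s x y → a + s * x + s * y ≡ a + s * (x + y)
    factor = solve-∀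

  prime∣pCk : ∀ {p} → Prime p → ∀ k → 0 < k → k < p → p ∣ p C k
  prime∣pCk {suc n} p-prime (suc k) _ k<p
    with euclidsLemma (suc k) (suc n C suc k) p-prime
           (divides (n C k) (trans ([1+k]*[1+n]C[1+k]≡[1+n]*nCk n k) (*-comm (suc n) (n C k))))
  ... | inj₁ p∣1+k = contradiction (∣⇒≤ p∣1+k) (<⇒≱ k<p)
  ... | inj₂ p∣pCk = p∣pCk

-- The prime is written suc n so that binomial sums over Fin (suc q) can be split at both ends.
module Frobenius {n : ℕ} (q-prime : Prime (suc n)) where

  open import Algebra.Bundles using (module CommutativeRing)
  import Algebra.Properties.Semiring.Binomial as Binomial
  import Algebra.Properties.Semiring.Exp as Exp
  open import Data.Fin as Fin using (Fin; toℕ; fromℕ; inject₁)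
  import Data.Fin.Properties as Fin
  open import Data.Integer as ℤ using (+_)
  import Data.Integer.Properties as ℤ
  open import Data.List using ([])
  open import Data.Nat as ℕ using (_∸_; s≤s; z≤n)
  import Data.Nat.Properties as ℕ
  open import Data.Nat.Combinatorics using (_C_; nCn≡1)
  open import Data.Nat.Divisibility as ℕ using (divides)
  open import Relation.Binary.PropositionalEquality
  import Relation.Binary.Reasoning.Setoid as SetoidReasoning
  open Polynomial
  open Divisibility
  open PrimeBinomial using (prime∣pCk)
  open FactorTheorem using (π; π≋1-X)
  open ℤ[X]-Solver using (solve; _:=_; _:+_; _:-_)

  q : ℕ
  q = suc n

  open Congruence (const (+ q))
  open CommutativeRing quotientRing using (semiring; +-rawMonoid; *-comm)
  open import Algebra.Definitions.RawMonoid +-rawMonoid using (_×_; sum)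
  open Exp semiring using () renaming (_^_ to _^Q_)
  open Exp (CommutativeRing.semiring ℤ[X]) using (^-congʳ; ^-assocʳ)

  ×≋const⊗ : ∀ m t → m × t ≋ const (+ m) ⊗ t
  ×≋const⊗ zero    t = ≋-sym (⊗-zeroˡ {const (+ 0)} t const-0)
  ×≋const⊗ (suc m) t = ≋-trans (⊕-cong (≋-sym (⊗-identityˡ t)) (×≋const⊗ m t)) (≋-sym (⊗-distribʳ 1P (const (+ m)) t))

  multiple-of-q≈[] : ∀ {m} t → q ℕ.∣ m → m × t ≈ []
  multiple-of-q≈[] {m} t (divides c m≡cq) = ∣⇒≈[] (divides (const (+ c) ⊗ t) (begin
    const (+ q) ⊗ (const (+ c) ⊗ t)       ≈⟨ ⊗-assoc (const (+ q)) (const (+ c)) t ⟨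
    (const (+ q) ⊗ const (+ c)) ⊗ t       ≈⟨ ⊗-congʳ t {const (+ q) ⊗ const (+ c)} {const (+ m)} (mk≋ λ { zero → q*c≡m ; (suc k) → refl }) ⟩
    const (+ m) ⊗ t                       ≈⟨ ×≋const⊗ m t ⟨
    m × t                                 ∎))
    where
    open SetoidReasoning ≋-setoid
    q*c≡m : + q ℤ.* + c ℤ.+ + 0 ≡ + m
    q*c≡m = trans (ℤ.+-identityʳ (+ q ℤ.* + c)) (trans (sym (ℤ.pos-* q c)) (cong +_ (trans (ℕ.*-comm q c) (sym m≡cq))))

  sum-last : ∀ m (g : Fin (suc m) → Poly) → (∀ i → g (inject₁ i) ≈ []) → sum g ≈ g (fromℕ m)
  sum-last zero    g _     = ≋⇒≈ (⊕-identityʳ (g Fin.zero))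
  sum-last (suc m) g g≈[] = ⊕-cong≈ (g≈[] Fin.zero) (sum-last m (λ i → g (Fin.suc i)) (λ i → g≈[] (Fin.suc i)))

  -- The binomial theorem uses the quotient semiring's own _^_, which is not definitionally ours.
  ^Q≡^ : ∀ x m → x ^Q m ≡ x ^ m
  ^Q≡^ x zero    = refl
  ^Q≡^ x (suc m) = cong (x ⊗_) (^Q≡^ x m)

  freshmans-dream : ∀ x y → (x ⊕ y) ^ q ≈ x ^ q ⊕ y ^ q
  freshmans-dream x y = begin
    (x ⊕ y) ^ q                                                     ≡⟨ ^Q≡^ (x ⊕ y) q ⟨
    (x ⊕ y) ^Q q                                                    ≈⟨ theorem (*-comm x y) q ⟩
    binomialTerm q Fin.zero ⊕ sum (λ i → binomialTerm q (Fin.suc i))  ≈⟨ ⊕-cong≈ first (sum-last n (λ i → binomialTerm q (Fin.suc i)) middle) ⟩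
    y ^ q ⊕ binomialTerm q (Fin.suc (fromℕ n))                      ≈⟨ ⊕-cong≈ (≈-refl {y ^ q}) last ⟩
    y ^ q ⊕ x ^ q                                                   ≈⟨ ≋⇒≈ (⊕-comm (y ^ q) (x ^ q)) ⟩
    x ^ q ⊕ y ^ q                                                   ∎
    where
    open SetoidReasoning ≈-setoid
    open Binomial semiring x y using (theorem; binomialTerm)
    first : binomialTerm q Fin.zero ≈ y ^ q
    first rewrite ^Q≡^ y q = ≋⇒≈ (≋-trans (⊕-identityʳ (1P ⊗ y ^ q)) (⊗-identityˡ (y ^ q)))
    middle : ∀ i → binomialTerm q (Fin.suc (inject₁ i)) ≈ []
    middle i = multiple-of-q≈[] _ (prime∣pCk q-prime (suc (toℕ (inject₁ i))) (s≤s z≤n) (s≤s (Fin.inject₁ℕ< i)))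
    last : binomialTerm q (Fin.suc (fromℕ n)) ≈ x ^ q
    last rewrite Fin.toℕ-fromℕ n | nCn≡1 q | ℕ.n∸n≡0 n | ^Q≡^ x q = ≋⇒≈ (≋-trans (⊕-identityʳ (x ^ q ⊗ 1P)) (⊗-identityʳ (x ^ q)))

  neg^q : ∀ x → neg x ^ q ≈ neg (x ^ q)
  neg^q x = begin
    neg x ^ q                               ≈⟨ ≋⇒≈ (regroup (x ^ q) (neg x ^ q)) ⟩
    (x ^ q ⊕ neg x ^ q) ⊕ neg (x ^ q)       ≈⟨ ⊕-cong≈ (≈-sym (freshmans-dream x (neg x))) (≈-refl {neg (x ^ q)}) ⟩
    (x ⊕ neg x) ^ q ⊕ neg (x ^ q)           ≈⟨ ⊕-cong≈ (^-cong≈ q (≋⇒≈ (⊕-inverseʳ x))) (≈-refl {neg (x ^ q)}) ⟩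
    [] ^ q ⊕ neg (x ^ q)                    ≡⟨⟩
    neg (x ^ q)                             ∎
    where
    open SetoidReasoning ≈-setoid
    regroup : ∀ a b → b ≋ (a ⊕ b) ⊕ neg a
    regroup = solve 2 (λ a b → b := (a :+ b) :- a) ≋-refl

  π^q^j≈1-X^q^j : ∀ j → π ^ (q ℕ.^ j) ≈ 1P ⊕ neg (X ^ (q ℕ.^ j))
  π^q^j≈1-X^q^j zero    = ≋⇒≈ (≋-trans (⊗-identityʳ π) (≋-trans π≋1-X (⊕-congˡ 1P (neg-cong (≋-sym (⊗-identityʳ X))))))
  π^q^j≈1-X^q^j (suc j) = begin
    π ^ (q ℕ.* Q)                     ≈⟨ ≋⇒≈ (^-congʳ π (ℕ.*-comm q Q)) ⟩
    π ^ (Q ℕ.* q)                     ≈⟨ ≋⇒≈ (^-assocʳ π Q q) ⟨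
    (π ^ Q) ^ q                       ≈⟨ ^-cong≈ q (π^q^j≈1-X^q^j j) ⟩
    (1P ⊕ neg (X ^ Q)) ^ q            ≈⟨ freshmans-dream 1P (neg (X ^ Q)) ⟩
    1P ^ q ⊕ neg (X ^ Q) ^ q          ≈⟨ ⊕-cong≈ (≋⇒≈ (1P^≋1P q)) (neg^q (X ^ Q)) ⟩
    1P ⊕ neg ((X ^ Q) ^ q)            ≈⟨ ≋⇒≈ (⊕-congˡ 1P (neg-cong (^-assocʳ X Q q))) ⟩
    1P ⊕ neg (X ^ (Q ℕ.* q))          ≈⟨ ≋⇒≈ (⊕-congˡ 1P (neg-cong (^-congʳ X (ℕ.*-comm Q q)))) ⟩
    1P ⊕ neg (X ^ (q ℕ.* Q))          ∎
    where
    open SetoidReasoning ≈-setoid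
    Q : ℕ
    Q = q ℕ.^ j

module PowerBound where

  open import Data.Nat
  open import Data.Nat.Properties

  n<m^n : ∀ {m} → 1 < m → ∀ n → n < m ^ n
  n<m^n {m} 1<m zero    = s≤s z≤n
  n<m^n {m} 1<m (suc n) = begin-strict
    suc n               <⟨ s≤s (n<m^n 1<m n) ⟩
    1 + m ^ n           ≤⟨ +-monoˡ-≤ (m ^ n) (≤-trans (s≤s z≤n) (n<m^n 1<m n)) ⟩
    m ^ n + m ^ n       ≡⟨ cong (_+_ (m ^ n)) (+-identityʳ (m ^ n)) ⟨
    2 * m ^ n           ≤⟨ *-monoˡ-≤ (m ^ n) 1<m ⟩
    m * m ^ n           ∎
    where
    open ≤-Reasoning
    open import Relation.Binary.PropositionalEquality using (cong)


module PrimalityCriterion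
  (Φ : Poly) {d′ : ℕ} (monic : Degree.Monic (suc d′) Φ)
  {q : ℕ} (q-prime : Prime q) (Φ[1]≡q : Evaluation.eval (+ 1) Φ ≡ + q)
  (e : ℕ) (u : Poly) (π^e≈q⊗u : Congruence._≈_ Φ (FactorTheorem.π Polynomial.^ e) (Polynomial.const (+ q) ⊗ u))
  where

  open import Algebra.Bundles using (module CommutativeRing)
  import Algebra.Properties.CommutativeSemiring.Exp as CommExp
  import Algebra.Properties.Semiring.Exp as Exp
  open import Data.Empty using (⊥; ⊥-elim)
  open import Data.Integer as ℤ using (ℤ; -_)
  import Data.Integer.Divisibility.Signed as ℤ
  import Data.Integer.Properties as ℤ
  open import Data.List using ([])
  open import Data.Nat as ℕ using (zero; _≤_; _<_; s≤s)
  open import Data.Nat.Divisibility as ℕ using (divides; _∣?_)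
  import Data.Nat.Properties as ℕ
  open import Data.Nat.Primality using (euclidsLemma; prime⇒nonZero; prime⇒nonTrivial)
  open import Data.Product using (Σ-syntax; _×_; _,_)
  open import Data.Sum using (_⊎_; inj₁; inj₂)
  open import Relation.Binary.PropositionalEquality
  import Relation.Binary.Reasoning.Setoid as SetoidReasoning
  open import Relation.Nullary using (¬_; yes; no)
  open Polynomial
  open Divisibility
  open Evaluation
  open FactorTheorem
  open Degree
  open Reduction Φ monic
  open Congruence Φ
  open PowerBound using (n<m^n)
  open ℤ[X]-Solver using (solve; _:=_; _:*_; _:-_)
  open Exp (CommutativeRing.semiring ℤ[X]) using (^-congʳ; ^-assocʳ; ^-homo-*)
  open CommExp (CommutativeRing.commutativeSemiring ℤ[X]) using (^-distrib-*)

  instance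
    q≢0 : ℕ.NonZero q
    q≢0 = prime⇒nonZero q-prime

  root-of-cofactor : ∀ {h g} → Φ ⊗ h ≋ π ⊗ g → eval (+ 1) h ≡ + 0
  root-of-cofactor {h} {g} Φh≋πg = ℤ.*-cancelˡ-≡ (+ q) (eval (+ 1) h) (+ 0) (begin
    + q ℤ.* eval (+ 1) h                ≡⟨ cong (ℤ._* eval (+ 1) h) Φ[1]≡q ⟨
    eval (+ 1) Φ ℤ.* eval (+ 1) h       ≡⟨ eval-⊗ (+ 1) Φ h ⟨
    eval (+ 1) (Φ ⊗ h)                  ≡⟨ eval-cong (+ 1) Φh≋πg ⟩
    eval (+ 1) (π ⊗ g)                  ≡⟨ eval-⊗ (+ 1) π g ⟩
    + 0 ℤ.* eval (+ 1) g                ≡⟨ ℤ.*-zeroˡ (eval (+ 1) g) ⟩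
    + 0                                 ≡⟨ ℤ.*-zeroʳ (+ q) ⟨
    + q ℤ.* + 0                         ∎)
    where open ≡-Reasoning

  π-cancel : ∀ {g} → Φ ∣ π ⊗ g → Φ ∣ g
  π-cancel {g} (divides h Φh≋πg) = divides h′ (π⊗-cancel (begin
    π ⊗ (Φ ⊗ h′)      ≈⟨ swap π Φ h′ ⟩
    Φ ⊗ (π ⊗ h′)      ≈⟨ ⊗-congˡ Φ πh′≋h ⟩
    Φ ⊗ h             ≈⟨ Φh≋πg ⟩
    π ⊗ g             ∎))
    where
    open SetoidReasoning ≋-setoid
    swap : ∀ a b c → a ⊗ (b ⊗ c) ≋ b ⊗ (a ⊗ c)
    swap = solve 3 (λ a b c → a :* (b :* c) := b :* (a :* c)) ≋-refl
    π∣h : π ∣ h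
    π∣h = root-1⇒π∣ (root-of-cofactor Φh≋πg)
    h′ : Poly
    h′ = quotient π∣h
    πh′≋h : π ⊗ h′ ≋ h
    πh′≋h = equality π∣h

  π^-cancel : ∀ m {g} → Φ ∣ π ^ m ⊗ g → Φ ∣ g
  π^-cancel zero    {g} Φ∣g   = ∣-respʳ (⊗-identityˡ g) Φ∣g
  π^-cancel (suc m) {g} Φ∣π^g = π^-cancel m (π-cancel (∣-respʳ (⊗-assoc π (π ^ m) g) Φ∣π^g))

  -- U is not divisible by π, even modulo Φ.
  Unit : Poly → Set
  Unit U = ¬ (q ℕ.∣ ℤ.∣ eval (+ 1) U ∣)

  Φ∤unit⊗unit : ∀ {U V} → Unit U → Unit V → ¬ Φ ∣ U ⊗ V
  Φ∤unit⊗unit {U} {V} U-unit V-unit Φ∣UV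
    with euclidsLemma ℤ.∣ eval (+ 1) U ∣ ℤ.∣ eval (+ 1) V ∣ q-prime (subst₂ ℕ._∣_ |Φ[1]|≡q |UV[1]|≡ (eval-∣ (+ 1) Φ∣UV))
    where
    |Φ[1]|≡q : ℤ.∣ eval (+ 1) Φ ∣ ≡ q
    |Φ[1]|≡q = cong ℤ.∣_∣ Φ[1]≡q
    |UV[1]|≡ : ℤ.∣ eval (+ 1) (U ⊗ V) ∣ ≡ ℤ.∣ eval (+ 1) U ∣ ℕ.* ℤ.∣ eval (+ 1) V ∣
    |UV[1]|≡ = trans (cong ℤ.∣_∣ (eval-⊗ (+ 1) U V)) (ℤ.abs-* (eval (+ 1) U) (eval (+ 1) V))
  ... | inj₁ q∣U[1] = U-unit q∣U[1]
  ... | inj₂ q∣V[1] = V-unit q∣V[1]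

  eval-⊖multiple : ∀ U c → eval (+ 1) U ≡ c ℤ.* + q → eval (+ 1) (U ⊕ neg (const c ⊗ Φ)) ≡ + 0
  eval-⊖multiple U c U[1]≡cq = begin
    eval (+ 1) (U ⊕ neg (const c ⊗ Φ))                          ≡⟨ eval-⊕ (+ 1) U (neg (const c ⊗ Φ)) ⟩
    eval (+ 1) U ℤ.+ eval (+ 1) (neg (const c ⊗ Φ))             ≡⟨ cong (ℤ._+_ (eval (+ 1) U)) (eval-neg (+ 1) (const c ⊗ Φ)) ⟩
    eval (+ 1) U ℤ.+ - eval (+ 1) (const c ⊗ Φ)                 ≡⟨ cong (λ z → eval (+ 1) U ℤ.+ - z) (eval-⊗ (+ 1) (const c) Φ) ⟩
    eval (+ 1) U ℤ.+ - (eval (+ 1) (const c) ℤ.* eval (+ 1) Φ)  ≡⟨ cong₂ (λ x y → eval (+ 1) U ℤ.+ - (x ℤ.* y)) (eval-const (+ 1) c) Φ[1]≡q ⟩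
    eval (+ 1) U ℤ.+ - (c ℤ.* + q)                              ≡⟨ cong (λ z → z ℤ.+ - (c ℤ.* + q)) U[1]≡cq ⟩
    c ℤ.* + q ℤ.+ - (c ℤ.* + q)                                 ≡⟨ ℤ.+-inverseʳ (c ℤ.* + q) ⟩
    + 0                                                         ∎
    where open ≡-Reasoning

  non-unit⇒π∣ : ∀ U → q ℕ.∣ ℤ.∣ eval (+ 1) U ∣ → Σ[ U′ ∈ Poly ] U ≈ π ⊗ U′
  non-unit⇒π∣ U q∣U[1] with ℤ.∣ᵤ⇒∣ {+ q} {eval (+ 1) U} q∣U[1]
  ... | ℤ.divides c U[1]≡cq = quotient π∣W , mk≈ (divides (const c) (begin
    Φ ⊗ const c                         ≈⟨ regroup U (const c) Φ ⟩
    U ⊕ neg W                           ≈⟨ ⊕-congˡ U (neg-cong (equality π∣W)) ⟨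
    U ⊕ neg (π ⊗ quotient π∣W)          ∎))
    where
    open SetoidReasoning ≋-setoid
    W : Poly
    W = U ⊕ neg (const c ⊗ Φ)
    regroup : ∀ U C Φ → Φ ⊗ C ≋ U ⊕ neg (U ⊕ neg (C ⊗ Φ))
    regroup = solve 3 (λ U C Φ → Φ :* C := U :- (U :- C :* Φ)) ≋-refl
    π∣W : π ∣ W
    π∣W = root-1⇒π∣ (eval-⊖multiple U c U[1]≡cq)

  Decomposition : Poly → Set
  Decomposition F = Σ[ i ∈ ℕ ] Σ[ U ∈ Poly ] F ≈ π ^ i ⊗ U × Unit U

  π-adic-expansion : ∀ N F → (Σ[ U ∈ Poly ] F ≈ π ^ N ⊗ U) ⊎ Decomposition F
  π-adic-expansion zero    F = inj₁ (F , ≋⇒≈ (≋-sym (⊗-identityˡ F)))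
  π-adic-expansion (suc N) F with π-adic-expansion N F
  ... | inj₂ F-decomposed = inj₂ F-decomposed
  ... | inj₁ (U , F≈π^NU) with q ∣? ℤ.∣ eval (+ 1) U ∣
  ...   | no  U-unit = inj₂ (N , U , F≈π^NU , U-unit)
  ...   | yes q∣U[1] with non-unit⇒π∣ U q∣U[1]
  ...     | U′ , U≈πU′ = inj₁ (U′ , ≈-trans F≈π^NU (≈-trans (⊗-cong≈ (≈-refl {π ^ N}) U≈πU′) (≋⇒≈ (regroup (π ^ N) π U′))))
    where
    regroup : ∀ P π U′ → P ⊗ (π ⊗ U′) ≋ (π ⊗ P) ⊗ U′
    regroup = solve 3 (λ P π U′ → P :* (π :* U′) := (π :* P) :* U′) ≋-refl

  Σ|coeff| : Poly → ℕ → ℕ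
  Σ|coeff| p zero    = 0
  Σ|coeff| p (suc n) = ℤ.∣ coeff p n ∣ ℕ.+ Σ|coeff| p n

  |coeff|≤Σ|coeff| : ∀ p {k n} → k < n → ℤ.∣ coeff p k ∣ ≤ Σ|coeff| p n
  |coeff|≤Σ|coeff| p {k} {suc n} (s≤s k≤n) with ℕ.m≤n⇒m<n∨m≡n k≤n
  ... | inj₁ k<n  = ℕ.≤-trans (|coeff|≤Σ|coeff| p k<n) (ℕ.m≤n+m (Σ|coeff| p n) ℤ.∣ coeff p n ∣)
  ... | inj₂ refl = ℕ.m≤m+n ℤ.∣ coeff p k ∣ (Σ|coeff| p n)

  const-^ : ∀ m n → const (+ m) ^ n ≋ const (+ (m ℕ.^ n))
  const-^ m zero    = ≋-refl
  const-^ m (suc n) = ≋-trans (⊗-congˡ (const (+ m)) (const-^ m n))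
                              (≋-trans (≋-sym (const-* (+ m) (+ (m ℕ.^ n)))) (≋-reflexive (cong const (sym (ℤ.pos-* m (m ℕ.^ n))))))

  π^[S*e]≈q^S⊗ : ∀ S U → π ^ (S ℕ.* e) ⊗ U ≈ const (+ (q ℕ.^ S)) ⊗ (u ^ S ⊗ U)
  π^[S*e]≈q^S⊗ S U = begin
    π ^ (S ℕ.* e) ⊗ U                      ≈⟨ ≋⇒≈ (⊗-congʳ U (≋-trans (^-congʳ π (ℕ.*-comm S e)) (≋-sym (^-assocʳ π e S)))) ⟩
    (π ^ e) ^ S ⊗ U                        ≈⟨ ⊗-cong≈ (^-cong≈ S π^e≈q⊗u) (≈-refl {U}) ⟩
    (const (+ q) ⊗ u) ^ S ⊗ U              ≈⟨ ≋⇒≈ (⊗-congʳ U (^-distrib-* (const (+ q)) u S)) ⟩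
    (const (+ q) ^ S ⊗ u ^ S) ⊗ U          ≈⟨ ≋⇒≈ (⊗-congʳ U (⊗-congʳ (u ^ S) (const-^ q S))) ⟩
    (const (+ (q ℕ.^ S)) ⊗ u ^ S) ⊗ U      ≈⟨ ≋⇒≈ (⊗-assoc (const (+ (q ℕ.^ S))) (u ^ S) U) ⟩
    const (+ (q ℕ.^ S)) ⊗ (u ^ S ⊗ U)      ∎
    where open SetoidReasoning ≈-setoid

  reduce-multiple : ∀ {F} Q W → F ≈ const Q ⊗ W → reduce F ≋ scale Q (reduce W)
  reduce-multiple {F} Q W F≈QW = reduced-≈⇒≋ rF≈QrW (Deg<-reduce F) (Deg<-scale Q (reduce W) (Deg<-reduce W))
    where
    rF≈QrW : reduce F ≈ scale Q (reduce W)
    rF≈QrW = begin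
      reduce F               ≈⟨ ≈reduce F ⟨
      F                      ≈⟨ F≈QW ⟩
      const Q ⊗ W            ≈⟨ ⊗-cong≈ (≈-refl {const Q}) (≈reduce W) ⟩
      const Q ⊗ reduce W     ≈⟨ ≋⇒≈ (const⊗≋scale Q (reduce W)) ⟩
      scale Q (reduce W)     ∎
      where open SetoidReasoning ≈-setoid

  small-multiple≡0 : ∀ {x S} m → x ≤ S → S < q ℕ.^ S → x ≡ q ℕ.^ S ℕ.* m → x ≡ 0
  small-multiple≡0 {S = S} zero    _   _      x≡ = trans x≡ (ℕ.*-zeroʳ (q ℕ.^ S))
  small-multiple≡0 {S = S} (suc m) x≤S S<q^S x≡ =
    ⊥-elim (ℕ.<⇒≱ S<q^S (ℕ.≤-trans (ℕ.m≤m*n (q ℕ.^ S) (suc m)) (ℕ.≤-trans (ℕ.≤-reflexive (sym x≡)) x≤S)))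

  -- The coefficients of the reduced form are bounded by S but divisible by q^S > S.
  highly-π-divisible⇒≈[] : ∀ F U → F ≈ π ^ (Σ|coeff| (reduce F) d ℕ.* e) ⊗ U → F ≈ []
  highly-π-divisible⇒≈[] F U F≈ = ≈-trans (≈reduce F) (≋⇒≈ (mk≋ reduced-coefficient))
    where
    S : ℕ
    S = Σ|coeff| (reduce F) d
    W : Poly
    W = u ^ S ⊗ U
    rF≋ : reduce F ≋ scale (+ (q ℕ.^ S)) (reduce W)
    rF≋ = reduce-multiple (+ (q ℕ.^ S)) W (≈-trans F≈ (π^[S*e]≈q^S⊗ S U))
    |coeff|≡ : ∀ k → ℤ.∣ coeff (reduce F) k ∣ ≡ q ℕ.^ S ℕ.* ℤ.∣ coeff (reduce W) k ∣
    |coeff|≡ k = trans (cong ℤ.∣_∣ (trans (coeff-≡ rF≋ k) (coeff-scale (+ (q ℕ.^ S)) (reduce W) k)))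
                       (ℤ.abs-* (+ (q ℕ.^ S)) (coeff (reduce W) k))
    reduced-coefficient : ∀ k → coeff (reduce F) k ≡ + 0
    reduced-coefficient k with k ℕ.<? d
    ... | no  k≮d = Deg<-reduce F k (ℕ.≮⇒≥ k≮d)
    ... | yes k<d = ℤ.∣i∣≡0⇒i≡0 (small-multiple≡0 _ (|coeff|≤Σ|coeff| (reduce F) k<d) (n<m^n q>1 S) (|coeff|≡ k))
      where q>1 = ℕ.nonTrivial⇒n>1 q {{prime⇒nonTrivial q-prime}}

  descent : ∀ F → ¬ Φ ∣ F → Decomposition F
  descent F Φ∤F with π-adic-expansion (Σ|coeff| (reduce F) d ℕ.* e) F
  ... | inj₂ F-decomposed = F-decomposed
  ... | inj₁ (U , F≈) = ⊥-elim (Φ∤F (≈[]⇒∣ (highly-π-divisible⇒≈[] F U F≈)))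

  Φ-prime : ∀ {F G} → Φ ∣ F ⊗ G → ¬ Φ ∣ F → ¬ Φ ∣ G → ⊥
  Φ-prime {F} {G} Φ∣FG Φ∤F Φ∤G with descent F Φ∤F | descent G Φ∤G
  ... | i , U , F≈ , U-unit | j , V , G≈ , V-unit =
    Φ∤unit⊗unit {U} {V} U-unit V-unit (π^-cancel (i ℕ.+ j) (≈[]⇒∣ (≈-trans (≈-sym FG≈) (∣⇒≈[] Φ∣FG))))
    where
    regroup : ∀ a b U V → (a ⊗ U) ⊗ (b ⊗ V) ≋ (a ⊗ b) ⊗ (U ⊗ V)
    regroup = solve 4 (λ a b U V → (a :* U) :* (b :* V) := (a :* b) :* (U :* V)) ≋-refl
    FG≈ : F ⊗ G ≈ π ^ (i ℕ.+ j) ⊗ (U ⊗ V)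
    FG≈ = ≈-trans (⊗-cong≈ F≈ G≈) (≋⇒≈ (≋-trans (regroup (π ^ i) (π ^ j) U V) (⊗-congʳ (U ⊗ V) (≋-sym (^-homo-* π i j)))))

module GeometricDegree where

  open import Data.Integer as ℤ using (+_)
  import Data.Integer.Properties as ℤ
  open import Data.Nat as ℕ using (ℕ; zero; suc; s≤s; z≤n)
  import Data.Nat.Properties as ℕ
  open import Relation.Binary.PropositionalEquality
  open Polynomial
  open GeometricSums
  open Degree

  Monic-cong : ∀ {d p q} → p ≋ q → Monic d p → Monic d q
  Monic-cong {d} p≋q monic = record
    { degree< = Deg<-cong p≋q degree<
    ; leading = trans (sym (coeff-≡ p≋q d)) leading }
    where open Monic monic

  Monic-monomial : ∀ n → Monic n (monomial n)
  Monic-monomial n = record { degree< = degree< n ; leading = leading n }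
    where
    degree< : ∀ n → Deg< (suc n) (monomial n)
    degree< zero    (suc k) _         = refl
    degree< (suc n) (suc k) (s≤s n<k) = degree< n k n<k
    leading : ∀ n → coeff (monomial n) n ≡ + 1
    leading zero    = refl
    leading (suc n) = leading n

  Monic-geometric : ∀ n′ m → Monic (m ℕ.* suc n′) (geometric (X ^ suc n′) (suc m))
  Monic-geometric n′ zero    = Monic-cong (≋-sym (geometric-1 (X ^ suc n′))) (Monic-monomial 0)
  Monic-geometric n′ (suc m) = record
    { degree< = Deg<-⊕ 1P (y ⊗ g) (Deg<-mono 1P (s≤s z≤n) (Deg<-const (+ 1))) (Deg<-⊗ y g n (m ℕ.* n) y.degree< g.degree<)
    ; leading = begin
        coeff (1P ⊕ y ⊗ g) (n ℕ.+ m ℕ.* n)            ≡⟨ coeff-⊕ 1P (y ⊗ g) (n ℕ.+ m ℕ.* n) ⟩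
        + 0 ℤ.+ coeff (y ⊗ g) (n ℕ.+ m ℕ.* n)         ≡⟨ ℤ.+-identityˡ _ ⟩
        coeff (y ⊗ g) (n ℕ.+ m ℕ.* n)                 ≡⟨ coeff-⊗-top y g n (m ℕ.* n) y.degree< g.degree< ⟩
        coeff y n ℤ.* coeff g (m ℕ.* n)               ≡⟨ cong₂ ℤ._*_ y.leading g.leading ⟩
        + 1                                           ∎ }
    where
    open ≡-Reasoning
    n : ℕ
    n = suc n′
    y : Poly
    y = X ^ n
    g : Poly
    g = geometric y (suc m)
    module y = Monic (Monic-cong (monomial≋X^ n) (Monic-monomial n))
    module g = Monic (Monic-geometric n′ m)

module CyclotomicPrimePower where

  open import Data.Empty using (⊥)
  open import Data.Integer as ℤ using (+_)
  import Data.Integer.Properties as ℤ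
  open import Data.List using ([])
  open import Data.Nat as ℕ using (ℕ; suc; s≤s)
  open import Data.Nat.Divisibility as ℕ using (divides)
  import Data.Nat.Properties as ℕ
  open import Data.Nat.Primality using (Prime)
  open import Data.Product using (Σ-syntax; _,_)
  open import Relation.Binary.PropositionalEquality
  import Relation.Binary.Reasoning.Setoid as SetoidReasoning
  open import Relation.Nullary using (¬_)
  open Polynomial
  open Divisibility
  open Evaluation
  open FactorTheorem
  open GeometricSums
  open Degree
  open GeometricDegree
  open ℤ[X]-Solver using (solve; _:=_; _:-_)

  eval-Φpp : ∀ q b → eval (+ 1) (Φpp q b) ≡ + q
  eval-Φpp q b = trans (eval-cong (+ 1) (Φpp≋geometric q b)) (eval-geometric q (eval-X^ (q ℕ.^ b)))

  geometric-∣ : ∀ a t → geometric X a ∣ geometric X (a ℕ.* t)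
  geometric-∣ a t = divides (geometric (X ^ a) t) (geometric-⊗ a t)

  geometric-q^[1+b] : ∀ q b → geometric X (q ℕ.^ b) ⊗ Φpp q b ≋ geometric X (q ℕ.^ suc b)
  geometric-q^[1+b] q b = begin
    geometric X (q ℕ.^ b) ⊗ Φpp q b                          ≈⟨ ⊗-congˡ (geometric X (q ℕ.^ b)) (Φpp≋geometric q b) ⟩
    geometric X (q ℕ.^ b) ⊗ geometric (X ^ (q ℕ.^ b)) q      ≈⟨ geometric-⊗ (q ℕ.^ b) q ⟩
    geometric X (q ℕ.^ b ℕ.* q)                              ≡⟨ cong (geometric X) (ℕ.*-comm (q ℕ.^ b) q) ⟩
    geometric X (q ℕ.^ suc b)                                ∎
    where open SetoidReasoning ≋-setoid

  Φpp∣geometric : ∀ q b {M} → q ℕ.^ suc b ℕ.∣ M → Φpp q b ∣ geometric X M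
  Φpp∣geometric q b (divides t refl) =
    ∣-trans (divides (geometric X (q ℕ.^ b)) (≋-trans (⊗-comm (Φpp q b) _) (geometric-q^[1+b] q b)))
            (∣-respʳ (≋-reflexive (cong (geometric X) (ℕ.*-comm (q ℕ.^ suc b) t))) (geometric-∣ (q ℕ.^ suc b) t))

  private
    module Instance (r n′ b : ℕ) (q-prime : Prime (suc (suc r))) (q^b≡1+n′ : suc (suc r) ℕ.^ b ≡ suc n′) where

      q : ℕ
      q = suc (suc r)
      Φ : Poly
      Φ = Φpp q b
      N : ℕ
      N = q ℕ.^ suc b

      -- Φ_{q^(b+1)} has degree (q − 1) q^b = d′ + 1.
      d′ : ℕ
      d′ = n′ ℕ.+ r ℕ.* suc n′

      monic : Monic (suc d′) Φ
      monic = Monic-cong (≋-sym Φ≋) (Monic-geometric n′ (suc r))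
        where
        Φ≋ : Φ ≋ geometric (X ^ suc n′) q
        Φ≋ = subst (λ z → Φ ≋ geometric (X ^ z) q) q^b≡1+n′ (Φpp≋geometric q b)

      frobenius : const (+ q) ∣ π ^ N ⊕ neg (1P ⊕ neg (X ^ N))
      frobenius = Congruence.divides-difference (Frobenius.π^q^j≈1-X^q^j q-prime (suc b))

      u : Poly
      u = quotient frobenius

      π^N≈q⊗u : Congruence._≈_ Φ (π ^ N) (const (+ q) ⊗ u)
      π^N≈q⊗u = Congruence.mk≈ (∣-respʳ (≋-sym π^N-qu≋) (∣-⊗ˡ π (Φpp∣geometric q b ℕ.∣-refl)))
        where
        open SetoidReasoning ≋-setoid
        cancel : ∀ a b → a ⊕ neg (a ⊕ neg b) ≋ b
        cancel = solve 2 (λ a b → a :- (a :- b) := b) ≋-refl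
        π^N-qu≋ : π ^ N ⊕ neg (const (+ q) ⊗ u) ≋ π ⊗ geometric X N
        π^N-qu≋ = begin
          π ^ N ⊕ neg (const (+ q) ⊗ u)                        ≈⟨ ⊕-congˡ (π ^ N) (neg-cong (equality frobenius)) ⟩
          π ^ N ⊕ neg (π ^ N ⊕ neg (1P ⊕ neg (X ^ N)))         ≈⟨ cancel (π ^ N) (1P ⊕ neg (X ^ N)) ⟩
          1P ⊕ neg (X ^ N)                                     ≈⟨ π⊗geometric N ⟨
          π ⊗ geometric X N                                    ∎

      open PrimalityCriterion Φ monic q-prime (eval-Φpp q b) N u π^N≈q⊗u public using (Φ-prime)

      Φ∤geometric : ¬ Φ ∣ geometric X (q ℕ.^ b)
      Φ∤geometric Φ∣G =
        ℕ.0≢1+n (ℤ.+-injective (trans (sym (eval-≋[] (+ 1) G≋[])) (eval-geometric {X} (suc n′) (eval-X (+ 1)))))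
        where
        open Reduction Φ monic using (∣∧Deg<⇒≋[])
        G : Poly
        G = geometric X (suc n′)
        G<d : Deg< (suc d′) G
        G<d = Deg<-cong (geometric-cong (suc n′) (⊗-identityʳ X))
                (Deg<-mono (geometric (X ^ 1) (suc n′)) (s≤s (ℕ.≤-trans (ℕ.≤-reflexive (ℕ.*-identityʳ n′)) (ℕ.m≤m+n n′ (r ℕ.* suc n′))))
                  (Monic.degree< (Monic-geometric 0 n′)))
        G≋[] : G ≋ []
        G≋[] = ∣∧Deg<⇒≋[] (subst (λ z → Φ ∣ geometric X z) q^b≡1+n′ Φ∣G) G<d

    power-as-suc : ∀ r b → Σ[ n′ ∈ ℕ ] suc (suc r) ℕ.^ b ≡ suc n′
    power-as-suc r b = predecessor (suc (suc r) ℕ.^ b) {{ℕ.m^n≢0 (suc (suc r)) b}}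
      where
      predecessor : ∀ n → .{{ℕ.NonZero n}} → Σ[ n′ ∈ ℕ ] n ≡ suc n′
      predecessor (suc n′) = n′ , refl

  Φpp-prime : ∀ {q} b → Prime q → ∀ {F G} → Φpp q b ∣ F ⊗ G → ¬ Φpp q b ∣ F → ¬ Φpp q b ∣ G → ⊥
  Φpp-prime {suc (suc r)} b q-prime with power-as-suc r b
  ... | n′ , q^b≡1+n′ = Instance.Φ-prime r n′ b q-prime q^b≡1+n′

  Φpp∤geometric : ∀ {q} b → Prime q → ¬ Φpp q b ∣ geometric X (q ℕ.^ b)
  Φpp∤geometric {suc (suc r)} b q-prime with power-as-suc r b
  ... | n′ , q^b≡1+n′ = Instance.Φ∤geometric r n′ b q-prime q^b≡1+n′

module UniqueCartesianProduct where

  open import Data.List using (List; []; _∷_; map; cartesianProductWith)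
  open import Data.List.Membership.Propositional using (_∈_)
  open import Data.List.Membership.Propositional.Properties using (∈-map⁻; ∈-cartesianProductWith⁻)
  open import Data.Empty using (⊥)
  import Data.List.Relation.Unary.All as All
  import Data.List.Relation.Unary.All.Properties as All
  open import Data.List.Relation.Unary.Any using (here; there)
  open import Data.List.Relation.Unary.Unique.Propositional using (Unique; []; _∷_)
  open import Data.List.Relation.Unary.Unique.Propositional.Properties using (++⁺)
  open import Data.Product using (_×_; _,_; proj₁; proj₂)
  open import Relation.Binary.PropositionalEquality using (_≡_; _≢_; refl)

  Unique-map : ∀ {A B : Set} (f : A → B) {xs} → (∀ {x y} → x ∈ xs → y ∈ xs → f x ≡ f y → x ≡ y) → Unique xs → Unique (map f xs)
  Unique-map f {[]}     _     []          = []
  Unique-map f {x ∷ xs} f-inj (x∉xs ∷ xs!) =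
    All.map⁺ (All.tabulate λ y∈xs fx≡fy → All.lookup x∉xs y∈xs (f-inj (here refl) (there y∈xs) fx≡fy))
    ∷ Unique-map f (λ x∈ y∈ → f-inj (there x∈) (there y∈)) xs!

  Unique-cartesianProductWith : ∀ {A B C : Set} (f : A → B → C) {xs ys} →
    (∀ {a a′ b b′} → a ∈ xs → a′ ∈ xs → b ∈ ys → b′ ∈ ys → f a b ≡ f a′ b′ → a ≡ a′ × b ≡ b′) →
    Unique xs → Unique ys → Unique (cartesianProductWith f xs ys)
  Unique-cartesianProductWith f {[]}     _     _            _   = []
  Unique-cartesianProductWith f {x ∷ xs} {ys} f-inj (x∉xs ∷ xs!) ys! =
    ++⁺ (Unique-map (f x) (λ b∈ b′∈ e → proj₂ (f-inj (here refl) (here refl) b∈ b′∈ e)) ys!)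
        (Unique-cartesianProductWith f (λ a∈ a′∈ → f-inj (there a∈) (there a′∈)) xs! ys!)
        disjoint
    where
    disjoint : ∀ {v} → v ∈ map (f x) ys × v ∈ cartesianProductWith f xs ys → ⊥
    disjoint (v∈map , v∈rest) with ∈-map⁻ (f x) v∈map | ∈-cartesianProductWith⁻ f xs ys v∈rest
    ... | b , b∈ys , refl | a′ , b′ , a′∈xs , b′∈ys , fxb≡fa′b′ =
      All.lookup x∉xs a′∈xs (proj₁ (f-inj (here refl) (there a′∈xs) b∈ys b′∈ys fxb≡fa′b′))

module CyclicTilings where

  open import Data.List using (List; cartesianProductWith; upTo)
  open import Data.List.Relation.Binary.Permutation.Propositional using (_↭_)
  open import Data.Nat using (ℕ; NonZero; _+_)
  open import Data.Nat.DivMod using (_%_)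

  -- A tiles the cyclic group ℤ_M with complement C: the residues of the sums a + c enumerate ℤ_M exactly once.
  record CyclicTiling (A : List ℕ) : Set where
    field
      period        : ℕ
      {{period≢0}}  : NonZero period
      complement    : List ℕ
      residues↭     : cartesianProductWith (λ a c → (a + c) % period) A complement ↭ upTo period

module PeriodicTiling (A : List ℕ) (tiling : Tiles A) where

  open import Data.Bool using (Bool; true; false)
  open import Data.Empty using (⊥-elim)
  open import Data.Fin using (Fin; zero; suc; toℕ; fromℕ<; funToFin; finToFun)
  open import Data.Fin.Properties using (toℕ-fromℕ<; finToFun-funToFin; pigeonhole)
  open import Data.Integer as ℤ using (ℤ; +_)
  import Data.Integer.Properties as ℤ
  open import Algebra.Properties.AbelianGroup ℤ.+-0-abelianGroup using (∙-cancelˡ)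
  open import Data.List using (filter; upTo; cartesianProductWith)
  open import Data.List.Extrema.Nat using (min; max; argmin-sel; min≤xs; xs≤max)
  open import Data.List.Membership.Propositional using (_∈_)
  open import Data.List.Membership.Propositional.Properties
    using (∈-filter⁺; ∈-filter⁻; ∈-upTo⁺; ∈-upTo⁻; ∈-cartesianProductWith⁺; ∈-cartesianProductWith⁻)
  open import Data.List.Membership.Propositional.Properties.WithK using (unique∧set⇒bag)
  open import Data.List.Relation.Binary.BagAndSetEquality using (∼bag⇒↭)
  open import Data.List.Relation.Binary.Permutation.Propositional using (_↭_)
  import Data.List.Relation.Unary.All as All
  open import Data.List.Relation.Unary.Unique.Propositional using (Unique)
  open import Data.List.Relation.Unary.Unique.Propositional.Properties using (filter⁺; upTo⁺)
  open import Data.Nat as ℕ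
  open import Data.Nat.DivMod using (_%_; _/_; m≡m%n+[m/n]*n; [m+kn]%n≡m%n; m<n⇒m%n≡m; m%n<n)
  open import Data.Nat.Properties as ℕ
  open import Data.Nat.Tactic.RingSolver using (solve-∀)
  open import Data.Product using (Σ-syntax; ∃-syntax; _×_; _,_; proj₁; proj₂)
  open import Data.Sum using (inj₁; inj₂)
  open import Function using (mk⇔)
  open import Relation.Binary.PropositionalEquality
  open import Relation.Nullary using (Dec; yes; no; does)
  open import Relation.Nullary.Decidable using (does-⇔)
  open UniqueCartesianProduct using (Unique-cartesianProductWith)
  open CyclicTilings using (CyclicTiling)

  C : ℤ → Set
  C = proj₁ tiling

  Cℕ : ℕ → Set
  Cℕ n = C (+ n)

  translate-unique : ∀ {a a′ x x′} → a ∈ A → Cℕ x → a′ ∈ A → Cℕ x′ → a + x ≡ a′ + x′ → a ≡ a′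
  translate-unique {a} {a′} {x} {x′} a∈A Cx a′∈A Cx′ a+x≡a′+x′ with proj₂ tiling (+ (a + x))
  ... | _ , _ , _ , unique = trans (proj₁ (unique a (+ x) a∈A Cx (ℤ.pos-+ a x)))
                                   (sym (proj₁ (unique a′ (+ x′) a′∈A Cx′ (trans (cong +_ a+x≡a′+x′) (ℤ.pos-+ a′ x′)))))

  some-element : Σ[ a ∈ ℕ ] a ∈ A
  some-element with proj₂ tiling (+ 0)
  ... | a , _ , (a∈A , _) , _ = a , a∈A

  a₀ : ℕ
  a₀ = min (proj₁ some-element) A

  a₀∈A : a₀ ∈ A
  a₀∈A with argmin-sel (λ x → x) (proj₁ some-element) A
  ... | inj₁ a₀≡ = subst (_∈ A) (sym a₀≡) (proj₂ some-element)
  ... | inj₂ a₀∈ = a₀∈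

  a₀≤ : ∀ {a} → a ∈ A → a₀ ≤ a
  a₀≤ = All.lookup (min≤xs (proj₁ some-element) A)

  D : ℕ
  D = max 0 A

  ≤D : ∀ {a} → a ∈ A → a ≤ D
  ≤D = All.lookup (xs≤max 0 A)

  C? : ∀ n → Dec (Cℕ n)
  C? n with proj₂ tiling (+ a₀ ℤ.+ + n)
  ... | a , c , (a∈A , Cc , a₀+n≡a+c) , unique with a ℕ.≟ a₀
  ...   | yes refl = yes (subst C (∙-cancelˡ (+ a₀) c (+ n) (sym a₀+n≡a+c)) Cc)
  ...   | no  a≢a₀ = no λ Cn → a≢a₀ (sym (proj₁ (unique a₀ (+ n) a₀∈A Cn refl)))

  cover : ∀ n → D ≤ n → ∃[ a ] ∃[ x ] a ∈ A × Cℕ x × a + x ≡ n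
  cover n D≤n with proj₂ tiling (+ n)
  ... | a , c , (a∈A , Cc , n≡a+c) , _ with m≤n⇒∃[o]m+o≡n (≤-trans (≤D a∈A) D≤n)
  ...   | x , a+x≡n = a , x , a∈A , subst C c≡x Cc , a+x≡n
    where
    c≡x : c ≡ + x
    c≡x = ∙-cancelˡ (+ a) c (+ x) (trans (sym n≡a+c) (trans (cong +_ (sym a+x≡n)) (ℤ.pos-+ a x)))

  χ : ℕ → Bool
  χ n = does (C? n)

  χ≡true⇒C : ∀ {n} → χ n ≡ true → Cℕ n
  χ≡true⇒C {n} χn≡true with C? n
  ... | yes Cn = Cn

  C⇒χ≡true : ∀ {n} → Cℕ n → χ n ≡ true
  C⇒χ≡true {n} Cn with C? n
  ... | yes _  = refl
  ... | no ¬Cn = ⊥-elim (¬Cn Cn)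

  SameWindow : ℕ → ℕ → Set
  SameWindow w w′ = ∀ i → i < D → χ (w + i) ≡ χ (w′ + i)

  -- w′ + D + a₀ = a + x with x ∈ C; if a ≠ a₀ then x lies in the window of w′, and the matching point of
  -- the window of w gives w + D + a₀ a second representation besides a₀ + (w + D).
  next-in-C : ∀ {w w′} → SameWindow w w′ → Cℕ (w + D) → Cℕ (w′ + D)
  next-in-C {w} {w′} same C[w+D] with cover (w′ + D + a₀) (≤-trans (m≤n+m D w′) (m≤m+n (w′ + D) a₀))
  ... | a , x , a∈A , Cx , a+x≡ with a ℕ.≟ a₀
  ...   | yes refl = subst Cℕ (+-cancelˡ-≡ a₀ x (w′ + D) (trans a+x≡ (+-comm (w′ + D) a₀))) Cx
  ...   | no  a≢a₀ with m≤n⇒∃[o]m+o≡n (≤-trans (≤D a∈A) (m≤m+n D a₀))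
  ...     | i , a+i≡D+a₀ = ⊥-elim (a≢a₀ (translate-unique a∈A C[w+i] a₀∈A C[w+D] (shuffle w a i D a₀ a+i≡D+a₀)))
    where
    i<D : i < D
    i<D = +-cancelˡ-< a i D (subst (_< a + D) (sym a+i≡D+a₀)
            (subst (D + a₀ <_) (+-comm D a) (+-monoʳ-< D (≤∧≢⇒< (a₀≤ a∈A) (λ a₀≡a → a≢a₀ (sym a₀≡a))))))
    shuffle : ∀ w a i D a₀ → a + i ≡ D + a₀ → a + (w + i) ≡ a₀ + (w + D)
    shuffle w a i D a₀ e = trans (left w a i) (trans (cong (_+_ w) e) (right w D a₀))
      where
      left : ∀ w a i → a + (w + i) ≡ w + (a + i)
      left = solve-∀
      right : ∀ w D a₀ → w + (D + a₀) ≡ a₀ + (w + D)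
      right = solve-∀
    x≡w′+i : x ≡ w′ + i
    x≡w′+i = +-cancelˡ-≡ a x (w′ + i) (trans a+x≡ (trans (+-assoc w′ D a₀) (trans (cong (_+_ w′) (sym a+i≡D+a₀)) (swap w′ a i))))
      where
      swap : ∀ w a i → w + (a + i) ≡ a + (w + i)
      swap = solve-∀
    C[w+i] : Cℕ (w + i)
    C[w+i] = χ≡true⇒C (trans (same i i<D) (C⇒χ≡true (subst Cℕ x≡w′+i Cx)))

  χ-next : ∀ {w w′} → SameWindow w w′ → χ (w + D) ≡ χ (w′ + D)
  χ-next same = does-⇔ (mk⇔ (next-in-C same) (next-in-C (λ i i<D → sym (same i i<D)))) (C? _) (C? _)

  SameWindow-suc : ∀ {w w′} → SameWindow w w′ → SameWindow (suc w) (suc w′)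
  SameWindow-suc {w} {w′} same i i<D with m≤n⇒m<n∨m≡n i<D
  ... | inj₁ 1+i<D = trans (cong χ (sym (+-suc w i))) (trans (same (suc i) 1+i<D) (cong χ (+-suc w′ i)))
  ... | inj₂ 1+i≡D = begin
    χ (suc w + i)     ≡⟨ cong χ (trans (sym (+-suc w i)) (cong (_+_ w) 1+i≡D)) ⟩
    χ (w + D)         ≡⟨ χ-next same ⟩
    χ (w′ + D)        ≡⟨ cong χ (trans (sym (+-suc w′ i)) (cong (_+_ w′) 1+i≡D)) ⟨
    χ (suc w′ + i)    ∎
    where open ≡-Reasoning

  SameWindow-+ : ∀ {w w′} → SameWindow w w′ → ∀ n → SameWindow (w + n) (w′ + n)
  SameWindow-+ {w} {w′} same zero    = subst₂ SameWindow (sym (+-identityʳ w)) (sym (+-identityʳ w′)) same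
  SameWindow-+ {w} {w′} same (suc n) = subst₂ SameWindow (sym (+-suc w n)) (sym (+-suc w′ n)) (SameWindow-suc (SameWindow-+ same n))

  χ-after-window : ∀ {w w′} → SameWindow w w′ → ∀ n → χ (w + D + n) ≡ χ (w′ + D + n)
  χ-after-window {w} {w′} same n =
    trans (cong χ (swap w D n)) (trans (χ-next (SameWindow-+ same n)) (cong χ (sym (swap w′ D n))))
    where
    swap : ∀ w D n → w + D + n ≡ w + n + D
    swap = solve-∀

  bit : Bool → Fin 2
  bit false = zero
  bit true  = suc zero

  bit-injective : ∀ {b b′} → bit b ≡ bit b′ → b ≡ b′
  bit-injective {false} {false} _ = refl
  bit-injective {true}  {true}  _ = refl

  window-code : ℕ → Fin (2 ^ D)
  window-code w = funToFin {D} {2} (λ i → bit (χ (w + toℕ i)))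

  window-code-injective : ∀ {w w′} → window-code w ≡ window-code w′ → SameWindow w w′
  window-code-injective {w} {w′} code≡ i i<D = begin
    χ (w + i)                       ≡⟨ cong (λ k → χ (w + k)) (toℕ-fromℕ< i<D) ⟨
    χ (w + toℕ k)                   ≡⟨ bit-injective (begin
      bit (χ (w + toℕ k))              ≡⟨ finToFun-funToFin {D} {2} (λ i → bit (χ (w + toℕ i))) k ⟨
      finToFun {2} {D} (window-code w) k    ≡⟨ cong (λ c → finToFun {2} {D} c k) code≡ ⟩
      finToFun {2} {D} (window-code w′) k   ≡⟨ finToFun-funToFin {D} {2} (λ i → bit (χ (w′ + toℕ i))) k ⟩
      bit (χ (w′ + toℕ k))             ∎) ⟩
    χ (w′ + toℕ k)                  ≡⟨ cong (λ k → χ (w′ + k)) (toℕ-fromℕ< i<D) ⟩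
    χ (w′ + i)                      ∎
    where
    open ≡-Reasoning
    k : Fin D
    k = fromℕ< i<D

  repeated-window : ∃[ w ] ∃[ p ] NonZero p × SameWindow w (w + p)
  repeated-window with pigeonhole (n<1+n (2 ^ D)) (λ i → window-code (toℕ i))
  ... | i , j , i<j , codes≡ with m≤n⇒∃[o]m+o≡n (<⇒≤ i<j)
  ...   | zero  , i+0≡j = ⊥-elim (<-irrefl (trans (sym (+-identityʳ (toℕ i))) i+0≡j) i<j)
  ...   | suc p , i+p≡j = toℕ i , suc p , _ , subst (SameWindow (toℕ i)) (sym i+p≡j) (window-code-injective codes≡)

  periodic-after-window : ∀ {w p} → SameWindow w (w + p) → ∀ x → w + D ≤ x → χ (x + p) ≡ χ x
  periodic-after-window {w} {p} same x w+D≤x with m≤n⇒∃[o]m+o≡n w+D≤x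
  ... | n , w+D+n≡x = subst (λ y → χ (y + p) ≡ χ y) w+D+n≡x
                            (trans (cong χ (swap w D n p)) (sym (χ-after-window same n)))
    where
    swap : ∀ w D n p → w + D + n + p ≡ w + p + D + n
    swap = solve-∀

  module Residues {w M : ℕ} .{{_ : NonZero M}} (same : SameWindow w (w + M)) where

    threshold : ℕ
    threshold = w + D

    χ-periodic : ∀ x → threshold ≤ x → χ (x + M) ≡ χ x
    χ-periodic = periodic-after-window same

    χ-periodic* : ∀ x k → threshold ≤ x → χ (x + k * M) ≡ χ x
    χ-periodic* x zero    _        = cong χ (+-identityʳ x)
    χ-periodic* x (suc k) threshold≤x = begin
      χ (x + (M + k * M))     ≡⟨ cong χ (swap x M (k * M)) ⟩
      χ (x + k * M + M)       ≡⟨ χ-periodic (x + k * M) (≤-trans threshold≤x (m≤m+n x (k * M))) ⟩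
      χ (x + k * M)           ≡⟨ χ-periodic* x k threshold≤x ⟩
      χ x                     ∎
      where
      open ≡-Reasoning
      swap : ∀ x M K → x + (M + K) ≡ x + K + M
      swap = solve-∀

    representative : ℕ → ℕ
    representative c = c + threshold * M

    threshold≤representative : ∀ c → threshold ≤ representative c
    threshold≤representative c = ≤-trans (m≤m*n threshold M) (m≤n+m (threshold * M) c)

    χ-class : ∀ c k → threshold ≤ c + k * M → χ (c + k * M) ≡ χ (representative c)
    χ-class c k threshold≤ = begin
      χ (c + k * M)                   ≡⟨ χ-periodic* (c + k * M) threshold threshold≤ ⟨
      χ (c + k * M + threshold * M)       ≡⟨ cong χ (swap c (k * M) (threshold * M)) ⟩
      χ (c + threshold * M + k * M)       ≡⟨ χ-periodic* (representative c) k (threshold≤representative c) ⟩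
      χ (representative c)            ∎
      where
      open ≡-Reasoning
      swap : ∀ c K S → c + K + S ≡ c + S + K
      swap = solve-∀

    C₀ : List ℕ
    C₀ = filter (λ c → C? (representative c)) (upTo M)

    C₀-unique : Unique C₀
    C₀-unique = filter⁺ (λ c → C? (representative c)) (upTo⁺ M)

    ∈C₀⁻ : ∀ {c} → c ∈ C₀ → c < M × Cℕ (representative c)
    ∈C₀⁻ c∈C₀ with ∈-filter⁻ (λ c → C? (representative c)) {xs = upTo M} c∈C₀
    ... | c∈upTo , C[rep] = ∈-upTo⁻ c∈upTo , C[rep]

    K : ℕ
    K = D + threshold

    residues-cover : ∀ r → r < M → ∃[ a ] ∃[ c ] a ∈ A × c ∈ C₀ × (a + c) % M ≡ r
    residues-cover r r<M with cover (r + K * M) (≤-trans (m≤m+n D threshold) (≤-trans (m≤m*n K M) (m≤n+m (K * M) r)))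
    ... | a , x , a∈A , Cx , a+x≡ = a , c , a∈A , c∈C₀ , (begin
      (a + c) % M                ≡⟨ [m+kn]%n≡m%n (a + c) k M ⟨
      (a + c + k * M) % M        ≡⟨ cong (_% M) (trans (+-assoc a c (k * M)) (cong (_+_ a) (sym x≡))) ⟩
      (a + x) % M                ≡⟨ cong (_% M) a+x≡ ⟩
      (r + K * M) % M            ≡⟨ [m+kn]%n≡m%n r K M ⟩
      r % M                      ≡⟨ m<n⇒m%n≡m r<M ⟩
      r                          ∎)
      where
      open ≡-Reasoning
      c : ℕ
      c = x % M
      k : ℕ
      k = x / M
      x≡ : x ≡ c + k * M
      x≡ = m≡m%n+[m/n]*n x M
      threshold≤x : threshold ≤ x
      threshold≤x = +-cancelˡ-≤ a threshold x
        (≤-trans (+-monoˡ-≤ threshold (≤D a∈A)) (≤-trans (m≤m*n K M) (≤-trans (m≤n+m (K * M) r) (≤-reflexive (sym a+x≡)))))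
      c∈C₀ : c ∈ C₀
      c∈C₀ = ∈-filter⁺ (λ c → C? (representative c)) (∈-upTo⁺ (m%n<n x M))
               (χ≡true⇒C (trans (sym (χ-class c k (subst (threshold ≤_) x≡ threshold≤x))) (trans (cong χ (sym x≡)) (C⇒χ≡true Cx))))

    in-class : ∀ {c} v → c ∈ C₀ → Cℕ (c + (K + v) * M)
    in-class {c} v c∈C₀ = χ≡true⇒C (trans (χ-class c (K + v) threshold≤) (C⇒χ≡true (proj₂ (∈C₀⁻ c∈C₀))))
      where
      threshold≤ : threshold ≤ c + (K + v) * M
      threshold≤ = ≤-trans (m≤n+m threshold D) (≤-trans (m≤m+n K v) (≤-trans (m≤m*n (K + v) M) (m≤n+m ((K + v) * M) c)))

    residues-unique : ∀ {a a′ c c′} → a ∈ A → a′ ∈ A → c ∈ C₀ → c′ ∈ C₀ → (a + c) % M ≡ (a′ + c′) % M → a ≡ a′ × c ≡ c′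
    residues-unique {a} {a′} {c} {c′} a∈A a′∈A c∈C₀ c′∈C₀ residues≡ = a≡a′ , c≡c′
      where
      s : ℕ
      s = (a + c) % M
      u : ℕ
      u = (a + c) / M
      u′ : ℕ
      u′ = (a′ + c′) / M
      a+c≡ : a + c ≡ s + u * M
      a+c≡ = m≡m%n+[m/n]*n (a + c) M
      a′+c′≡ : a′ + c′ ≡ s + u′ * M
      a′+c′≡ = trans (m≡m%n+[m/n]*n (a′ + c′) M) (cong (_+ u′ * M) (sym residues≡))
      shift : ∀ a c s u u′ → a + c ≡ s + u * M → a + (c + (K + u′) * M) ≡ s + (K + u + u′) * M
      shift a c s u u′ e = trans (regroup₁ a c K u′ M) (trans (cong (_+ (K + u′) * M) e) (regroup₂ s u M K u′))
        where
        regroup₁ : ∀ a c K u′ M → a + (c + (K + u′) * M) ≡ a + c + (K + u′) * M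
        regroup₁ = solve-∀
        regroup₂ : ∀ s u M K u′ → s + u * M + (K + u′) * M ≡ s + (K + u + u′) * M
        regroup₂ = solve-∀
      sums≡ : a + (c + (K + u′) * M) ≡ a′ + (c′ + (K + u) * M)
      sums≡ = trans (shift a c s u u′ a+c≡) (trans (cong (λ t → s + t * M) (swap K u u′)) (sym (shift a′ c′ s u′ u a′+c′≡)))
        where
        swap : ∀ K u u′ → K + u + u′ ≡ K + u′ + u
        swap = solve-∀
      a≡a′ : a ≡ a′
      a≡a′ = translate-unique a∈A (in-class u′ c∈C₀) a′∈A (in-class u c′∈C₀) sums≡
      c≡c′ : c ≡ c′
      c≡c′ = begin
        c                               ≡⟨ m<n⇒m%n≡m (proj₁ (∈C₀⁻ c∈C₀)) ⟨
        c % M                           ≡⟨ [m+kn]%n≡m%n c (K + u′) M ⟨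
        (c + (K + u′) * M) % M          ≡⟨ cong (_% M) (+-cancelˡ-≡ a _ _ (trans sums≡ (cong (_+ (c′ + (K + u) * M)) (sym a≡a′)))) ⟩
        (c′ + (K + u) * M) % M          ≡⟨ [m+kn]%n≡m%n c′ (K + u) M ⟩
        c′ % M                          ≡⟨ m<n⇒m%n≡m (proj₁ (∈C₀⁻ c′∈C₀)) ⟩
        c′                              ∎
        where open ≡-Reasoning

    residues : List ℕ
    residues = cartesianProductWith (λ a c → (a + c) % M) A C₀

    residues↭upTo : Unique A → residues ↭ upTo M
    residues↭upTo A! = ∼bag⇒↭ (unique∧set⇒bag residues! (upTo⁺ M) (mk⇔ ∈residues⇒<M <M⇒∈residues))
      where
      residues! : Unique residues
      residues! = Unique-cartesianProductWith (λ a c → (a + c) % M) residues-unique A! C₀-unique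
      ∈residues⇒<M : ∀ {r} → r ∈ residues → r ∈ upTo M
      ∈residues⇒<M r∈ with ∈-cartesianProductWith⁻ (λ a c → (a + c) % M) A C₀ r∈
      ... | a , c , _ , _ , refl = ∈-upTo⁺ (m%n<n (a + c) M)
      <M⇒∈residues : ∀ {r} → r ∈ upTo M → r ∈ residues
      <M⇒∈residues r∈ with residues-cover _ (∈-upTo⁻ r∈)
      ... | a , c , a∈A , c∈C₀ , refl = ∈-cartesianProductWith⁺ (λ a c → (a + c) % M) a∈A c∈C₀

  cyclic-tiling : Unique A → CyclicTiling A
  cyclic-tiling A! with repeated-window
  ... | w , M , M≢0 , same = record
    { period     = M
    ; period≢0   = M≢0
    ; complement = Residues.C₀ {{M≢0}} same
    ; residues↭  = Residues.residues↭upTo {{M≢0}} same A! }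

module CyclicComplement {A : List ℕ} (cyclic : CyclicTilings.CyclicTiling A) where

  open import Data.Integer as ℤ using (+_)
  import Data.Integer.Properties as ℤ
  open import Data.Nat using (_*_)
  open import Relation.Binary.PropositionalEquality
  open Polynomial
  open Divisibility
  open Evaluation
  open FactorTheorem using (π)
  open GeometricSums
  open Masks using (mask-↭; mask-upTo; eval-mask)
  open CyclicTilings.CyclicTiling cyclic renaming (period to M; complement to C₀)
  open Congruence (1P ⊕ neg (X ^ M))
  open ℤ[X]-Solver using (solve; _:=_; _:+_; _:-_)

  mask⊗mask≈geometric : mask A ⊗ mask C₀ ≈ geometric X M
  mask⊗mask≈geometric = ≈-trans (MasksModulo.mask-⊗≈ M A C₀) (≋⇒≈ (≋-trans (mask-↭ residues↭) (mask-upTo M)))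

  geometric∣mask⊗mask : geometric X M ∣ mask A ⊗ mask C₀
  geometric∣mask⊗mask = ∣-respʳ (regroup (mask A ⊗ mask C₀) (geometric X M))
    (∣-⊕ (∣-trans (divides π (≋-trans (⊗-comm (geometric X M) π) (π⊗geometric M))) (divides-difference mask⊗mask≈geometric)) ∣-refl)
    where
    regroup : ∀ p j → (p ⊕ neg j) ⊕ j ≋ p
    regroup = solve 2 (λ p j → (p :- j) :+ j := p) ≋-refl

  card-product : card A * card C₀ ≡ M
  card-product = ℤ.+-injective (begin
    + (card A * card C₀)                        ≡⟨ ℤ.pos-* (card A) (card C₀) ⟩
    + card A ℤ.* + card C₀                      ≡⟨ cong₂ ℤ._*_ (eval-mask A) (eval-mask C₀) ⟨
    eval (+ 1) (mask A) ℤ.* eval (+ 1) (mask C₀) ≡⟨ eval-⊗ (+ 1) (mask A) (mask C₀) ⟨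
    eval (+ 1) (mask A ⊗ mask C₀)               ≡⟨ eval-≈ (+ 1) 1-1≡0 mask⊗mask≈geometric ⟩
    eval (+ 1) (geometric X M)                  ≡⟨ eval-geometric M (eval-X (+ 1)) ⟩
    + M                                         ∎)
    where
    open ≡-Reasoning
    1-1≡0 : eval (+ 1) (1P ⊕ neg (X ^ M)) ≡ + 0
    1-1≡0 = trans (eval-⊕ (+ 1) 1P (neg (X ^ M))) (cong (ℤ._+_ (+ 1)) (trans (eval-neg (+ 1) (X ^ M)) (cong ℤ.-_ (eval-X^ M))))

module PrimeFactors where

  open import Data.Empty using (⊥)
  open import Data.Integer as ℤ using (+_)
  open import Data.Nat as ℕ using (zero; suc; _*_; _^_)
  open import Data.Nat.Divisibility as ℕ using (_∣_; *-pres-∣; ∣⇒≤)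
  import Data.Nat.Properties as ℕ
  open import Data.Nat.Primality using (Prime; prime⇒nonTrivial)
  open import Data.Product using (_,_)
  open import Relation.Binary.PropositionalEquality
  import Relation.Binary.Reasoning.Setoid as SetoidReasoning
  open import Relation.Nullary using (¬_)
  open Polynomial hiding (_^_)
  open Divisibility using (divides; quotient; equality; ∣-respʳ; ∣-trans; ∣⇒∣P; ∣P⇒∣) renaming (_∣_ to _∣X_)
  open Evaluation
  open GeometricSums
  open Masks using (eval-mask)
  open CyclotomicPrimePower
  open PowerBound using (n<m^n)

  ∣mask⇒∣card : ∀ {g n} C → g ∣X mask C → eval (+ 1) g ≡ + n → n ∣ card C
  ∣mask⇒∣card {g} C g∣C g[1]≡n = subst₂ _∣_ (cong ℤ.∣_∣ g[1]≡n) (cong ℤ.∣_∣ (eval-mask C)) (eval-∣ (+ 1) g∣C)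

  Φpp∣mask⇒q∣card : ∀ {q b} C → Φpp q b ∣X mask C → q ∣ card C
  Φpp∣mask⇒q∣card {q} {b} C Φ∣C = ∣mask⇒∣card C Φ∣C (eval-Φpp q b)

  module _ {A} (cyclic : CyclicTilings.CyclicTiling A) {q} (q-prime : Prime q) (q∣A : q ∣ card A) (no-factor : ∀ b → ¬ Φpp q b ∣X mask A) where

    open CyclicComplement cyclic
    open CyclicTilings.CyclicTiling cyclic using () renaming (period to M; complement to C₀)

    geometric-step : ∀ j → geometric X (q ^ j) ∣X mask C₀ → ¬ geometric X (q ^ suc j) ∣X mask C₀ → ⊥
    geometric-step j (divides H GH≋C₀) G′∤C₀ =
      Φpp-prime j q-prime Φ∣AC₀ (no-factor j) λ Φ∣C₀ →
        Φpp-prime j q-prime (∣-respʳ (≋-sym GH≋C₀) Φ∣C₀) (Φpp∤geometric j q-prime) λ Φ∣H →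
          G′∤C₀ (divides (quotient Φ∣H) (begin
            geometric X (q ^ suc j) ⊗ quotient Φ∣H                    ≈⟨ ⊗-congʳ (quotient Φ∣H) (geometric-q^[1+b] q j) ⟨
            (geometric X (q ^ j) ⊗ Φpp q j) ⊗ quotient Φ∣H            ≈⟨ ⊗-assoc (geometric X (q ^ j)) (Φpp q j) (quotient Φ∣H) ⟩
            geometric X (q ^ j) ⊗ (Φpp q j ⊗ quotient Φ∣H)            ≈⟨ ⊗-congˡ (geometric X (q ^ j)) (equality Φ∣H) ⟩
            geometric X (q ^ j) ⊗ H                                   ≈⟨ GH≋C₀ ⟩
            mask C₀                                                   ∎))
      where
      open SetoidReasoning ≋-setoid
      q^j∣C₀ : q ^ j ∣ card C₀
      q^j∣C₀ = ∣mask⇒∣card {geometric X (q ^ j)} C₀ (divides H GH≋C₀) (eval-geometric {X} (q ^ j) (eval-X (+ 1)))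
      q^[1+j]∣M : q ^ suc j ∣ M
      q^[1+j]∣M = subst (q ^ suc j ∣_) card-product (*-pres-∣ q∣A q^j∣C₀)
      Φ∣AC₀ : Φpp q j ∣X mask A ⊗ mask C₀
      Φ∣AC₀ = ∣-trans (Φpp∣geometric q j q^[1+j]∣M) geometric∣mask⊗mask

    ¬¬geometric∣C₀ : ∀ j → ¬ ¬ geometric X (q ^ j) ∣X mask C₀
    ¬¬geometric∣C₀ zero    G∤C₀ = G∤C₀ (divides (mask C₀) (≋-trans (⊗-congʳ (mask C₀) (geometric-1 X)) (⊗-identityˡ (mask C₀))))
    ¬¬geometric∣C₀ (suc j) G∤C₀ = ¬¬geometric∣C₀ j λ G∣C₀ → geometric-step j G∣C₀ G∤C₀

    no-cyclotomic-factor-absurd : ⊥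
    no-cyclotomic-factor-absurd = ¬¬geometric∣C₀ (card C₀) λ G∣C₀ →
      ℕ.<⇒≱ (n<m^n (ℕ.nonTrivial⇒n>1 q {{prime⇒nonTrivial q-prime}}) (card C₀))
            (∣⇒≤ {{C₀≢0}} (∣mask⇒∣card C₀ G∣C₀ (eval-geometric {X} (q ^ card C₀) (eval-X (+ 1)))))
      where
      C₀≢0 : ℕ.NonZero (card C₀)
      C₀≢0 = ℕ.≢-nonZero λ C₀≡0 → ℕ.≢-nonZero⁻¹ M (trans (sym card-product) (trans (cong (card A *_) C₀≡0) (ℕ.*-zeroʳ (card A))))

  InS⇒∣card : ∀ A {q} b → InS A q b → q ∣ card A
  InS⇒∣card A b (_ , Φ∣A) = Φpp∣mask⇒q∣card {b = b} A (∣P⇒∣ Φ∣A)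

  ∣card⇒¬¬InS : ∀ {A} → Unique A → Tiles A → ∀ {q} → Prime q → q ∣ card A → ¬ (∀ b → ¬ InS A q b)
  ∣card⇒¬¬InS {A} A! tiling q-prime q∣A no-InS =
    no-cyclotomic-factor-absurd (PeriodicTiling.cyclic-tiling A tiling A!) q-prime q∣A λ b Φ∣A → no-InS b (q-prime , ∣⇒∣P Φ∣A)

lemma2p5 : (A : List ℕ) → Unique A → Tiles A →
    AtMostTwoPrimeFactors (card A) ⇔ SAtMostTwoPrimes A
lemma2p5 A A! tiling = mk⇔
  (λ (p , r , p-prime , r-prime , p∨r) → p , r , p-prime , r-prime , λ q b q∈S → p∨r q (proj₁ q∈S) (InS⇒∣card A b q∈S))
  (λ (p , r , p-prime , r-prime , p∨r) → p , r , p-prime , r-prime , λ q q-prime q∣A →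
    decidable-stable ((q ≟ p) ⊎-dec (q ≟ r)) λ q≢p,r → ∣card⇒¬¬InS A! tiling q-prime q∣A λ b q∈S → q≢p,r (p∨r q b q∈S))
  where
  open import Data.Nat using (_≟_)
  open import Data.Product using (_,_; proj₁)
  open import Function.Bundles using (mk⇔)
  open import Relation.Nullary.Decidable using (_⊎-dec_; decidable-stable)
  open PrimeFactors using (InS⇒∣card; ∣card⇒¬¬InS)
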